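{- Let $\mathcal C\subseteq\mathbb{F}_q^n$ be a nonempty $q$-ary constant-weight code of length $n$ and constant weight $w$, with $M=|\mathcal C|$. Then for each $k=1,2,\dots,n$, $$S(k)\le T_1(k)+T_2(k)+T_3(k),$$ where $S(k)$, $T_1(k)$, $T_2(k)$, $T_3(k)$ are as defined in the context.
   Context: $\mathbb{F}_q$ is a finite field with $q$ elements, $\mathbb{F}_q^*=\mathbb{F}_q\setminus\{0\}$, enumerated as $\mathbb{F}_q=\{0=\omega_1,\dots,\omega_q\}$. A constant-weight code of length $n$ and weight $w$ is a subset of $\mathbb{F}_q^n$ all of whose elements have exactly $w$ nonzero coordinates. Regard $\mathcal C$ as an $M\times n$ matrix whose rows are the codewords; its columns are $u'_1,\dots,u'_n\in\mathbb{F}_q^M$. For $a\in\mathbb{F}_q^M$ and $c\in\{1,\dots,q\}$, $x_c(a)$ is the number of coordinates of $a$ equal to $\omega_c$. $$S(k)=\sum_{\alpha\in(\mathbb{F}_q^*)^k}\ \sum_{1\le i_1<\cdots<i_k\le n}\ \sum_{1\le c<d\le q} x_c(\alpha_1u'_{i_1}+\cdots+\alpha_ku'_{i_k})\, x_d(\alpha_1u'_{i_1}+\cdots+\alpha_ku'_{i_k}).$$ Let $P_k^-(n;x)=\frac12\sum_{j=0}^k\left[(q-1)^j-(-1)^j\right](q-1)^{k-j}\binom{x}{j}\binom{n-x}{k-j}$. Let $q_k,r_k$ be the quotient and remainder when dividing the integer $\frac{2(q-1)M}{q}P_k^-(n;w)$ by $(q-1)^k\binom{n}{k}$; let $s_k,t_k$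 be the quotient and remainder when dividing $q_k$ by $q-1$; let $s'_k,t'_k$ be the quotient and remainder when dividing $q_k+1$ by $q-1$. Define $$T_1(k)=\left[(q-1)^k\binom{n}{k}-r_k\right](M-q_k)q_k+r_k(M-q_k-1)(q_k+1),$$ $$T_2(k)=\left[(q-1)^k\binom{n}{k}-r_k\right]\left[\binom{q-1-t_k}{2}s_k^2+(q-1-t_k)t_ks_k(s_k+1)+\binom{t_k}{2}(s_k+1)^2\right],$$ $$T_3(k)=r_k\left[\binom{q-1-t'_k}{2}s_k'^2+(q-1-t'_k)t'_ks'_k(s'_k+1)+\binom{t'_k}{2}(s'_k+1)^2\right].$$ -}

module Defs where

open import Level using (Level; _⊔_) renaming (suc to lsuc)
open import Data.Nat as ℕ using (ℕ; zero; suc; _∸_; _<ᵇ_)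
open import Data.Nat.DivMod using (_/_; _%_)
open import Data.Nat.Combinatorics using (_C_)
open import Data.Integer as ℤ using (ℤ; +_)
open import Data.Fin using (Fin; toℕ) renaming (zero to fzero; suc to fsuc)
open import Data.List using (List; []; _∷_; [_]; map; concatMap; allFin; filter; filterᵇ; length; upTo)
open import Data.Nat.ListAction using (sum)
open import Data.Bool using (Bool; true; false; _∧_)
open import Data.Product using (∃; _,_)
open import Relation.Nullary using (¬_; Dec; yes; no)
open import Relation.Nullary.Decidable using (¬?)
open import Relation.Binary using (Decidable)
open import Relation.Binary.PropositionalEquality using (_≡_)
open import Algebra.Bundles using (CommutativeRing)

-- A finite field with q elements, together with an enumeration
-- F_q = {ω_1 = 0, ω_2, ..., ω_q}  (ω indexed by Fin q, ω_1 = ω fzero).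

record FiniteField (c ℓ : Level) (q : ℕ) : Set (lsuc (c ⊔ ℓ)) where
  field
    commRing : CommutativeRing c ℓ
  open CommutativeRing commRing public
  field
    _≟_      : Decidable _≈_
    0≉1      : ¬ (0# ≈ 1#)
    inverse  : ∀ x → ¬ (x ≈ 0#) → ∃ λ y → (x * y) ≈ 1#
    ω        : Fin q → Carrier
    ω-inj    : ∀ i j → ω i ≈ ω j → i ≡ j
    ω-surj   : ∀ x → ∃ λ i → ω i ≈ x
    ω-first  : ∀ i → toℕ i ≡ 0 → ω i ≈ 0#

consF : ∀ {a} {A : Set a} {k : ℕ} → A → (Fin k → A) → Fin (suc k) → A
consF x f fzero    = x
consF x f (fsuc i) = f i

allFuns : ∀ {a} {A : Set a} (k : ℕ) → List A → List (Fin k → A)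
allFuns zero    xs = [ (λ ()) ]
allFuns (suc k) xs = concatMap (λ x → map (consF x) (allFuns k xs)) xs

increasing : {k n : ℕ} → (Fin k → Fin n) → Bool
increasing {zero}        f = true
increasing {suc zero}    f = true
increasing {suc (suc k)} f =
  (toℕ (f fzero) <ᵇ toℕ (f (fsuc fzero))) ∧ increasing (λ t → f (fsuc t))

increasingSeqs : (k n : ℕ) → List (Fin k → Fin n)
increasingSeqs k n = filterᵇ increasing (allFuns k (allFin n))

data Pair (q : ℕ) : Set where
  pair : Fin q → Fin q → Pair q

orderedPairs : (q : ℕ) → List (Pair q)
orderedPairs q =
  concatMap (λ c → map (pair c) (filterᵇ (λ d → toℕ c <ᵇ toℕ d) (allFin q))) (allFin q)

-- quotient / remainder, with the (never used) convention x / 0 = 0, x % 0 = x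
quot : ℕ → ℕ → ℕ
quot m zero    = 0
quot m (suc d) = m / suc d

rem : ℕ → ℕ → ℕ
rem m zero    = m
rem m (suc d) = m % suc d

-- The quantities of the paper, for a code given as an M × n matrix
-- (rows = codewords) over F.

module _ {c ℓ : Level} {q : ℕ} (F : FiniteField c ℓ q) where
  open FiniteField F

  weight : {n : ℕ} → (Fin n → Carrier) → ℕ
  weight {n} v = length (filter (λ i → ¬? (v i ≟ 0#)) (allFin n))

  xcount : {M : ℕ} → Fin q → (Fin M → Carrier) → ℕ
  xcount {M} cc a = length (filter (λ r → a r ≟ ω cc) (allFin M))

  fsum : (k : ℕ) → (Fin k → Carrier) → Carrier
  fsum zero    f = 0#
  fsum (suc k) f = f fzero + fsum k (λ t → f (fsuc t))

  nonzeros : List Carrier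
  nonzeros = filter (λ x → ¬? (x ≟ 0#)) (map ω (allFin q))

  -- α_1 u'_{i_1} + ... + α_k u'_{i_k}  (u'_i = i-th column of the code)
  combo : {M n k : ℕ} → (Fin M → Fin n → Carrier) →
          (Fin k → Carrier) → (Fin k → Fin n) → Fin M → Carrier
  combo {k = k} code α idx r = fsum k (λ t → α t * code r (idx t))

  pairTerm : {M : ℕ} → (Fin M → Carrier) → Pair q → ℕ
  pairTerm a (pair cc d) = xcount cc a ℕ.* xcount d a

  S : {M n : ℕ} → (Fin M → Fin n → Carrier) → (k : ℕ) → ℕ
  S {M} {n} code k =
    sum (map (λ α →
      sum (map (λ idx →
        sum (map (pairTerm (combo code α idx)) (orderedPairs q)))
        (increasingSeqs k n)))
      (allFuns k nonzeros))

twoP : (q n x k : ℕ) → ℤ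
twoP q n x k = Data.List.foldr ℤ._+_ (+ 0) (map term (upTo (suc k)))
  where
  term : ℕ → ℤ
  term j = (((+ (q ∸ 1)) ℤ.^ j) ℤ.- (ℤ.- (+ 1)) ℤ.^ j)
           ℤ.* ((+ (q ∸ 1)) ℤ.^ (k ∸ j))
           ℤ.* (+ (x C j)) ℤ.* (+ ((n ∸ x) C (k ∸ j)))

-- the integer 2(q-1)M/q · P_k^-(n;w)  (= (q-1) M · 2P / q, exact division)
bigN : (q M n w k : ℕ) → ℕ
bigN q M n w k = quot ((q ∸ 1) ℕ.* M ℕ.* ℤ.∣ twoP q n w k ∣) q

bigE : (q n k : ℕ) → ℕ
bigE q n k = (q ∸ 1) ℕ.^ k ℕ.* (n C k)

bracket : (q s t : ℕ) → ℕ
bracket q s t =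
  ((q ∸ 1 ∸ t) C 2) ℕ.* (s ℕ.* s)
  ℕ.+ (q ∸ 1 ∸ t) ℕ.* t ℕ.* s ℕ.* (s ℕ.+ 1)
  ℕ.+ (t C 2) ℕ.* ((s ℕ.+ 1) ℕ.* (s ℕ.+ 1))

module Bound (q M n w k : ℕ) where
  E  = bigE q n k
  qk = quot (bigN q M n w k) E
  rk = rem  (bigN q M n w k) E
  sk = quot qk (q ∸ 1)
  tk = rem  qk (q ∸ 1)
  sk′ = quot (qk ℕ.+ 1) (q ∸ 1)
  tk′ = rem  (qk ℕ.+ 1) (q ∸ 1)

  T₁ : ℤ
  T₁ = ((+ E) ℤ.- (+ rk)) ℤ.* ((+ M) ℤ.- (+ qk)) ℤ.* (+ qk)
       ℤ.+ (+ rk) ℤ.* ((+ M) ℤ.- (+ qk) ℤ.- (+ 1)) ℤ.* ((+ qk) ℤ.+ (+ 1))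

  T₂ : ℤ
  T₂ = ((+ E) ℤ.- (+ rk)) ℤ.* (+ bracket q sk tk)

  T₃ : ℤ
  T₃ = (+ rk) ℤ.* (+ bracket q sk′ tk′)

T₁ T₂ T₃ : (q M n w k : ℕ) → ℤ
T₁ q M n w k = Bound.T₁ q M n w k
T₂ q M n w k = Bound.T₂ q M n w k
T₃ q M n w k = Bound.T₃ q M n w k

module Submission where

-- For a column a ∈ F^M with m nonzero entries, 2·Σ_{c<d} x_c x_d = M² − Σ_c x_c², where x_1 = M − m and the
-- other q − 1 counts sum to m, so their squares sum to at least the value for the most balanced split of m.
-- Twice the pair sum of a is therefore at most H(m) = M² − (M − m)² − (balanced sum of squares), a concave
-- function of m. Summing over the E = (q−1)^k C(n,k) combinations α₁u'_{i₁} + ⋯ + α_k u'_{i_k} and bounding H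
-- by its chord between qₖ and qₖ + 1 gives 2S(k) ≤ (E − rₖ)H(qₖ) + rₖH(qₖ + 1) = 2(T₁ + T₂ + T₃), as soon as the
-- total weight of the combinations is N = 2(q−1)M P_k^-(n;w)/q. That count is done row by row with the
-- character-sum identity q·#{α ∈ (F^*)^k : Σ α_t b_t ≠ 0} = (q−1)^{k+1} − (q−1)·Π_t ν(b_t), where ν(0) = q − 1
-- and ν(b) = −1 for b ≠ 0; summed over the index sets of a row of weight w, both (q−1)^k and Π_t ν(b_t) become
-- elementary symmetric sums, whose difference is 2P_k^-(n;w).


open import Defs

open import Level using (Level)
open import Algebra.Bundles using (CommutativeSemiring)
open import Data.Bool using (Bool; true; false; if_then_else_; not; _∧_)
open import Data.Fin as Fin using (Fin; toℕ; fromℕ<) renaming (zero to fzero; suc to fsuc)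
import Data.Fin.Properties as FinP
open import Data.List using (List; []; _∷_; map; foldr; _++_; concatMap; filter; allFin; tabulate; length; upTo)
import Data.List.Properties as ListP
import Data.Integer as ℤ
import Data.Integer.Properties as ℤP
open import Data.Integer.Tactic.RingSolver using (solve-∀)
open import Data.Nat.Combinatorics using (_C_; nCk+nC[k+1]≡[n+1]C[k+1]; nC1≡n)
open import Data.Nat.ListAction using (sum)
open import Data.Nat as ℕ using (ℕ; zero; suc; _∸_; _≤?_; _<_; _≤_; s≤s; z≤n)
import Data.Nat.Properties as ℕP
open import Function using (_∘_)
open import Relation.Binary using (tri<; tri≈; tri>)
open import Relation.Binary.PropositionalEquality as ≡ using (_≡_; _≢_)
open import Relation.Nullary using (Dec; does; yes; no; ¬_)
open import Data.Empty using (⊥-elim)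
open import Data.Product using (∃; _,_; proj₁; proj₂)
open import Relation.Nullary.Decidable using (dec-true; dec-false; T?; ¬?)
open import Relation.Unary using (Pred; Decidable)

𝟙 : Bool → ℕ
𝟙 b = if b then 1 else 0

decided : ∀ {p} {P : Set p} (P? : Dec P) → does P? ≡ true → P
decided (yes p) _ = p

module ListSum {c ℓ} (R : CommutativeSemiring c ℓ) where
  open CommutativeSemiring R
  open import Algebra.Properties.CommutativeSemigroup +-commutativeSemigroup using (interchange)
  open import Relation.Binary.Reasoning.Setoid setoid

  private variable
    a b : Level
    A : Set a
    B : Set b

  Σ : List Carrier → Carrier
  Σ = foldr _+_ 0#

  Σ-cong : {f g : A → Carrier} → (∀ x → f x ≈ g x) → ∀ xs → Σ (map f xs) ≈ Σ (map g xs)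
  Σ-cong f≈g []       = refl
  Σ-cong f≈g (x ∷ xs) = +-cong (f≈g x) (Σ-cong f≈g xs)

  Σ-++ : ∀ xs ys → Σ (xs ++ ys) ≈ Σ xs + Σ ys
  Σ-++ []       ys = sym (+-identityˡ _)
  Σ-++ (x ∷ xs) ys = trans (+-congˡ (Σ-++ xs ys)) (sym (+-assoc x _ _))

  Σ-map : (f : B → Carrier) (g : A → B) → ∀ xs → Σ (map f (map g xs)) ≈ Σ (map (f ∘ g) xs)
  Σ-map f g xs = reflexive (≡.cong Σ (≡.sym (ListP.map-∘ xs)))

  Σ-0 : ∀ (xs : List A) → Σ (map (λ _ → 0#) xs) ≈ 0#
  Σ-0 []       = refl
  Σ-0 (x ∷ xs) = trans (+-identityˡ _) (Σ-0 xs)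

  Σ-distrib-+ : ∀ (f g : A → Carrier) xs →
                Σ (map (λ x → f x + g x) xs) ≈ Σ (map f xs) + Σ (map g xs)
  Σ-distrib-+ f g []       = sym (+-identityˡ 0#)
  Σ-distrib-+ f g (x ∷ xs) =
    trans (+-congˡ (Σ-distrib-+ f g xs)) (interchange (f x) (g x) _ _)

  *-distribˡ-Σ : ∀ y (f : A → Carrier) xs → Σ (map (λ x → y * f x) xs) ≈ y * Σ (map f xs)
  *-distribˡ-Σ y f []       = sym (zeroʳ y)
  *-distribˡ-Σ y f (x ∷ xs) = trans (+-congˡ (*-distribˡ-Σ y f xs)) (sym (distribˡ y _ _))

  Σ-filter : ∀ {p} {P : Pred A p} (P? : Decidable P) (f : A → Carrier) xs →
             Σ (map f (filter P? xs)) ≈ Σ (map (λ x → if does (P? x) then f x else 0#) xs)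
  Σ-filter P? f []       = refl
  Σ-filter P? f (x ∷ xs) with does (P? x)
  ... | true  = +-congˡ (Σ-filter P? f xs)
  ... | false = trans (Σ-filter P? f xs) (sym (+-identityˡ _))

  Σ-concatMap : ∀ (f : B → Carrier) (g : A → List B) xs →
                Σ (map f (concatMap g xs)) ≈ Σ (map (λ x → Σ (map f (g x))) xs)
  Σ-concatMap f g []       = refl
  Σ-concatMap f g (x ∷ xs) = begin
    Σ (map f (g x ++ concatMap g xs))            ≡⟨ ≡.cong Σ (ListP.map-++ f (g x) _) ⟩
    Σ (map f (g x) ++ map f (concatMap g xs))    ≈⟨ Σ-++ (map f (g x)) _ ⟩
    Σ (map f (g x)) + Σ (map f (concatMap g xs)) ≈⟨ +-congˡ (Σ-concatMap f g xs) ⟩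
    Σ (map (λ x → Σ (map f (g x))) (x ∷ xs))     ∎

  Σ-swap : ∀ (f : A → B → Carrier) xs ys →
           Σ (map (λ x → Σ (map (f x) ys)) xs) ≈ Σ (map (λ y → Σ (map (λ x → f x y) xs)) ys)
  Σ-swap f []       ys = sym (Σ-0 ys)
  Σ-swap f (x ∷ xs) ys = trans (+-congˡ (Σ-swap f xs ys))
                               (sym (Σ-distrib-+ (f x) (λ y → Σ (map (λ x → f x y) xs)) ys))

  Σ-allFin-suc : ∀ {n} (f : Fin (suc n) → Carrier) →
                 Σ (map f (allFin (suc n))) ≈ f fzero + Σ (map (f ∘ fsuc) (allFin n))
  Σ-allFin-suc {n} f = begin
    Σ (map f (tabulate (λ i → i)))                ≡⟨ ≡.cong Σ (ListP.map-tabulate (λ i → i) f) ⟩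
    f fzero + Σ (tabulate (f ∘ fsuc))             ≡⟨ ≡.cong (λ xs → f fzero + Σ xs)
                                                       (≡.sym (ListP.map-tabulate (λ i → i) (f ∘ fsuc))) ⟩
    f fzero + Σ (map (f ∘ fsuc) (allFin n))       ∎

  Σ-upTo-suc : ∀ (f : ℕ → Carrier) m → Σ (map f (upTo (suc m))) ≈ f 0 + Σ (map (f ∘ suc) (upTo m))
  Σ-upTo-suc f m = reflexive (≡.cong (λ xs → f 0 + Σ xs)
    (≡.trans (ListP.map-applyUpTo suc f m) (≡.sym (ListP.map-applyUpTo (λ j → j) (f ∘ suc) m))))

  Σ-upTo-sucʳ : ∀ (f : ℕ → Carrier) m → Σ (map f (upTo (suc m))) ≈ Σ (map f (upTo m)) + f m
  Σ-upTo-sucʳ f zero    = +-comm (f 0) 0#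
  Σ-upTo-sucʳ f (suc m) = begin
    Σ (map f (upTo (suc (suc m))))                  ≈⟨ Σ-upTo-suc f (suc m) ⟩
    f 0 + Σ (map (f ∘ suc) (upTo (suc m)))          ≈⟨ +-congˡ (Σ-upTo-sucʳ (f ∘ suc) m) ⟩
    f 0 + (Σ (map (f ∘ suc) (upTo m)) + f (suc m))  ≈⟨ sym (+-assoc _ _ _) ⟩
    (f 0 + Σ (map (f ∘ suc) (upTo m))) + f (suc m)  ≈⟨ +-congʳ (sym (Σ-upTo-suc f m)) ⟩
    Σ (map f (upTo (suc m))) + f (suc m)            ∎

  Σ-upTo-cong : ∀ {f g : ℕ → Carrier} m → (∀ j → j < m → f j ≈ g j) →
                Σ (map f (upTo m)) ≈ Σ (map g (upTo m))
  Σ-upTo-cong             zero    f≈g = refl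
  Σ-upTo-cong {f} {g} (suc m) f≈g = begin
    Σ (map f (upTo (suc m)))                 ≈⟨ Σ-upTo-suc f m ⟩
    f 0 + Σ (map (f ∘ suc) (upTo m))         ≈⟨ +-cong (f≈g 0 (s≤s z≤n))
                                                  (Σ-upTo-cong m (λ j j<m → f≈g (suc j) (s≤s j<m))) ⟩
    g 0 + Σ (map (g ∘ suc) (upTo m))         ≈⟨ sym (Σ-upTo-suc g m) ⟩
    Σ (map g (upTo (suc m)))                 ∎

  Σ-unique : ∀ {n} (P : Fin n → Bool) (f : Fin n → Carrier) {x₀} → P x₀ ≡ true →
             (∀ x → P x ≡ true → x ≡ x₀) →
             Σ (map (λ x → if P x then f x else 0#) (allFin n)) ≈ f x₀
  Σ-unique {suc n} P f {fzero} Px₀ unique = begin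
    Σ (map (λ x → if P x then f x else 0#) (allFin (suc n)))
      ≈⟨ Σ-allFin-suc (λ x → if P x then f x else 0#) ⟩
    (if P fzero then f fzero else 0#) + Σ (map (λ x → if P (fsuc x) then f (fsuc x) else 0#) (allFin n))
      ≡⟨ ≡.cong (λ b → (if b then f fzero else 0#) + Σ (map (λ x → if P (fsuc x) then f (fsuc x) else 0#) (allFin n)))
                Px₀ ⟩
    f fzero + Σ (map (λ x → if P (fsuc x) then f (fsuc x) else 0#) (allFin n))
      ≈⟨ +-congˡ (trans (Σ-cong rest-vanishes (allFin n)) (Σ-0 (allFin n))) ⟩
    f fzero + 0#
      ≈⟨ +-identityʳ _ ⟩
    f fzero ∎
    where
    rest-vanishes : ∀ x → (if P (fsuc x) then f (fsuc x) else 0#) ≈ 0#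
    rest-vanishes x with P (fsuc x) in eq
    ... | false = refl
    ... | true  with () ← unique (fsuc x) eq
  Σ-unique {suc n} P f {fsuc x₀} Px₀ unique = begin
    Σ (map (λ x → if P x then f x else 0#) (allFin (suc n)))
      ≈⟨ Σ-allFin-suc (λ x → if P x then f x else 0#) ⟩
    (if P fzero then f fzero else 0#) + Σ (map (λ x → if P (fsuc x) then f (fsuc x) else 0#) (allFin n))
      ≈⟨ +-cong head-vanishes
                (Σ-unique (P ∘ fsuc) (f ∘ fsuc) Px₀ (λ x Px → FinP.suc-injective (unique (fsuc x) Px))) ⟩
    0# + f (fsuc x₀)
      ≈⟨ +-identityˡ _ ⟩
    f (fsuc x₀) ∎
    where
    head-vanishes : (if P fzero then f fzero else 0#) ≈ 0#
    head-vanishes with P fzero in eq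
    ... | false = refl
    ... | true  with () ← unique fzero eq

  Σ-from : ∀ {n} → ℕ → (Fin n → Carrier) → Carrier
  Σ-from {n} lo f = Σ (map (λ x → if does (lo ≤? toℕ x) then f x else 0#) (allFin n))

  Σ-from-beyond : ∀ {n} lo (f : Fin n → Carrier) → n ≤ lo → Σ-from lo f ≈ 0#
  Σ-from-beyond {n} lo f n≤lo = trans (Σ-cong vanishes (allFin n)) (Σ-0 (allFin n))
    where
    vanishes : ∀ x → (if does (lo ≤? toℕ x) then f x else 0#) ≈ 0#
    vanishes x rewrite dec-false (lo ≤? toℕ x) (ℕP.<⇒≱ (ℕP.<-≤-trans (FinP.toℕ<n x) n≤lo)) = refl

  Σ-from-step : ∀ {n} lo (f : Fin n → Carrier) (lo<n : lo < n) →
                Σ-from lo f ≈ f (fromℕ< lo<n) + Σ-from (suc lo) f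
  Σ-from-step {n} lo f lo<n = begin
    Σ-from lo f
      ≈⟨ Σ-cong split (allFin n) ⟩
    Σ (map (λ x → at x + Σ-from-term (suc lo) x) (allFin n))
      ≈⟨ Σ-distrib-+ at (Σ-from-term (suc lo)) (allFin n) ⟩
    Σ (map at (allFin n)) + Σ-from (suc lo) f
      ≈⟨ +-congʳ (Σ-unique (λ x → does (x Fin.≟ x₀)) f (dec-true (x₀ Fin.≟ x₀) ≡.refl)
                           (λ x → decided (x Fin.≟ x₀))) ⟩
    f x₀ + Σ-from (suc lo) f ∎
    where
    x₀ = fromℕ< lo<n
    Σ-from-term : ℕ → Fin n → Carrier
    Σ-from-term lo x = if does (lo ≤? toℕ x) then f x else 0#
    at : Fin n → Carrier
    at x = if does (x Fin.≟ x₀) then f x else 0#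
    x₀≢ : ∀ {x} → toℕ x ≢ lo → x ≢ x₀
    x₀≢ ne ≡.refl = ne (FinP.toℕ-fromℕ< lo<n)
    split : ∀ x → Σ-from-term lo x ≈ at x + Σ-from-term (suc lo) x
    split x with ℕP.<-cmp lo (toℕ x)
    ... | tri< lo<x lo≢x _
      rewrite dec-true (lo ≤? toℕ x) (ℕP.<⇒≤ lo<x) | dec-true (suc lo ≤? toℕ x) lo<x
            | dec-false (x Fin.≟ x₀) (x₀≢ (lo≢x ∘ ≡.sym)) = sym (+-identityˡ _)
    ... | tri≈ _ lo≡x _
      rewrite dec-true (lo ≤? toℕ x) (ℕP.≤-reflexive lo≡x)
            | dec-false (suc lo ≤? toℕ x) (ℕP.<⇒≱ (ℕP.≤-reflexive (≡.cong suc (≡.sym lo≡x))))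
            | dec-true (x Fin.≟ x₀) (FinP.toℕ-injective (≡.trans (≡.sym lo≡x) (≡.sym (FinP.toℕ-fromℕ< lo<n))))
      = sym (+-identityʳ _)
    ... | tri> _ lo≢x x<lo
      rewrite dec-false (lo ≤? toℕ x) (ℕP.<⇒≱ x<lo) | dec-false (suc lo ≤? toℕ x) (ℕP.<⇒≱ (ℕP.m<n⇒m<1+n x<lo))
            | dec-false (x Fin.≟ x₀) (x₀≢ (lo≢x ∘ ≡.sym)) = sym (+-identityˡ _)

module FieldFacts {c ℓ} {q : ℕ} (F : FiniteField c ℓ q) where
  open FiniteField F renaming (sym to ≈-sym; trans to ≈-trans)
  open import Relation.Binary.Reasoning.Setoid setoid

  isZero : Carrier → Bool
  isZero y = does (y ≟ 0#)

  isZero-cong : ∀ {x y} → x ≈ y → isZero x ≡ isZero y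
  isZero-cong {x} {y} x≈y with x ≟ 0# | y ≟ 0#
  ... | yes _   | yes _   = ≡.refl
  ... | no _    | no _    = ≡.refl
  ... | yes x≈0 | no y≉0  = ⊥-elim (y≉0 (≈-trans (≈-sym x≈y) x≈0))
  ... | no x≉0  | yes y≈0 = ⊥-elim (x≉0 (≈-trans x≈y y≈0))

  isZero-true : ∀ {y} → y ≈ 0# → isZero y ≡ true
  isZero-true {y} = dec-true (y ≟ 0#)

  isZero-false : ∀ {y} → ¬ y ≈ 0# → isZero y ≡ false
  isZero-false {y} = dec-false (y ≟ 0#)

  isZero-true⁻ : ∀ {y} → isZero y ≡ true → y ≈ 0#
  isZero-true⁻ {y} with y ≟ 0#
  ... | yes y≈0 = λ _ → y≈0

  isZero-false⁻ : ∀ {y} → isZero y ≡ false → ¬ y ≈ 0#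
  isZero-false⁻ {y} with y ≟ 0#
  ... | no y≉0 = λ _ → y≉0

  *-nonzero : ∀ {x y y⁻¹} → y * y⁻¹ ≈ 1# → ¬ x ≈ 0# → ¬ x * y ≈ 0#
  *-nonzero {x} {y} {y⁻¹} yy⁻¹≈1 x≉0 xy≈0 = x≉0 (begin
    x              ≈⟨ *-identityʳ x ⟨
    x * 1#         ≈⟨ *-congˡ yy⁻¹≈1 ⟨
    x * (y * y⁻¹)  ≈⟨ *-assoc x y y⁻¹ ⟨
    (x * y) * y⁻¹  ≈⟨ *-congʳ xy≈0 ⟩
    0# * y⁻¹       ≈⟨ zeroˡ y⁻¹ ⟩
    0#             ∎)

  root-unique : ∀ {e x y y⁻¹} → y * y⁻¹ ≈ 1# → e + x * y ≈ 0# → x ≈ (- e) * y⁻¹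
  root-unique {e} {x} {y} {y⁻¹} yy⁻¹≈1 e+xy≈0 = begin
    x              ≈⟨ *-identityʳ x ⟨
    x * 1#         ≈⟨ *-congˡ yy⁻¹≈1 ⟨
    x * (y * y⁻¹)  ≈⟨ *-assoc x y y⁻¹ ⟨
    (x * y) * y⁻¹  ≈⟨ *-congʳ xy≈-e ⟩
    (- e) * y⁻¹    ∎
    where
    xy≈-e : x * y ≈ - e
    xy≈-e = begin
      x * y                ≈⟨ +-identityˡ _ ⟨
      0# + x * y           ≈⟨ +-congʳ (-‿inverseˡ e) ⟨
      (- e + e) + x * y    ≈⟨ +-assoc _ _ _ ⟩
      - e + (e + x * y)    ≈⟨ +-congˡ e+xy≈0 ⟩
      - e + 0#             ≈⟨ +-identityʳ _ ⟩
      - e                  ∎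

  root-exists : ∀ {e y y⁻¹} → y * y⁻¹ ≈ 1# → e + ((- e) * y⁻¹) * y ≈ 0#
  root-exists {e} {y} {y⁻¹} yy⁻¹≈1 = begin
    e + ((- e) * y⁻¹) * y  ≈⟨ +-congˡ (*-assoc _ _ _) ⟩
    e + (- e) * (y⁻¹ * y)  ≈⟨ +-congˡ (*-congˡ (≈-trans (*-comm y⁻¹ y) yy⁻¹≈1)) ⟩
    e + (- e) * 1#         ≈⟨ +-congˡ (*-identityʳ _) ⟩
    e + - e                ≈⟨ -‿inverseʳ e ⟩
    0#                     ∎

open ℤ using (ℤ; +_; _+_; _-_; _*_; -_; _^_)

open import Algebra.Definitions.RawMonoid ℤ.*-1-rawMonoid using () renaming (sum to ∏)

module ℕΣ = ListSum ℕP.+-*-commutativeSemiring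
module ℤΣ = ListSum ℤP.+-*-commutativeSemiring
open ℤΣ using () renaming (Σ to Σℤ)

private variable
  ℓ₁ ℓ₂ : Level
  A : Set ℓ₁
  B : Set ℓ₂

pos-sum : ∀ (f : A → ℕ) xs → + sum (map f xs) ≡ Σℤ (map (+_ ∘ f) xs)
pos-sum f []       = ≡.refl
pos-sum f (x ∷ xs) = ≡.trans (ℤP.pos-+ (f x) _) (≡.cong (λ s → + f x + s) (pos-sum f xs))

sum-const : ∀ c (xs : List A) → sum (map (λ _ → c) xs) ≡ length xs ℕ.* c
sum-const c []       = ≡.refl
sum-const c (x ∷ xs) = ≡.cong (c ℕ.+_) (sum-const c xs)

Σℤ-const : ∀ c (xs : List A) → Σℤ (map (λ _ → c) xs) ≡ + length xs * c
Σℤ-const c []       = ≡.sym (ℤP.*-zeroˡ c)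
Σℤ-const c (x ∷ xs) = ≡.trans (≡.cong (λ s → c + s) (Σℤ-const c xs)) 
  (≡.sym (≡.trans (ℤP.*-distribʳ-+ c (+ 1) (+ length xs)) (≡.cong (_+ + length xs * c) (ℤP.*-identityˡ c))))

Σℤ-mono-≤ : ∀ {f g : A → ℤ} → (∀ x → f x ℤ.≤ g x) → ∀ xs → Σℤ (map f xs) ℤ.≤ Σℤ (map g xs)
Σℤ-mono-≤ f≤g []       = ℤP.≤-refl
Σℤ-mono-≤ f≤g (x ∷ xs) = ℤP.+-mono-≤ (f≤g x) (Σℤ-mono-≤ f≤g xs)

Σℤ-affine : ∀ a (f : A → ℤ) b xs → Σℤ (map (λ x → a + f x * b) xs) ≡ + length xs * a + Σℤ (map f xs) * b
Σℤ-affine a f b []       = ≡.refl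
Σℤ-affine a f b (x ∷ xs) = ≡.trans (≡.cong (λ s → a + f x * b + s) (Σℤ-affine a f b xs))
                                   (regroup a (f x) b (+ length xs) (Σℤ (map f xs)))
  where
  regroup : ∀ a y b L S → a + y * b + (L * a + S * b) ≡ (+ 1 + L) * a + (y + S) * b
  regroup = solve-∀

Σℤ-affine² : ∀ a (f : A → B → ℕ) d xs zs →
  Σℤ (map (λ x → Σℤ (map (λ z → a + + f x z * d) zs)) xs)
    ≡ + (length xs ℕ.* length zs) * a + + sum (map (λ x → sum (map (f x) zs)) xs) * d
Σℤ-affine² a f d xs zs = begin
  Σℤ (map (λ x → Σℤ (map (λ z → a + + f x z * d) zs)) xs)
    ≡⟨ ℤΣ.Σ-cong (λ x → ≡.trans (Σℤ-affine a (+_ ∘ f x) d zs)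
                                (≡.cong (λ s → + length zs * a + s * d) (≡.sym (pos-sum (f x) zs)))) xs ⟩
  Σℤ (map (λ x → + length zs * a + + sum (map (f x) zs) * d) xs)
    ≡⟨ Σℤ-affine (+ length zs * a) (λ x → + sum (map (f x) zs)) d xs ⟩
  + length xs * (+ length zs * a) + Σℤ (map (λ x → + sum (map (f x) zs)) xs) * d
    ≡⟨ ≡.cong₂ (λ l s → l + s * d) (≡.trans (≡.sym (ℤP.*-assoc (+ length xs) (+ length zs) a))
                                            (≡.cong (_* a) (≡.sym (ℤP.pos-* (length xs) (length zs)))))
                                   (≡.sym (pos-sum (λ x → sum (map (f x) zs)) xs)) ⟩
  + (length xs ℕ.* length zs) * a + + sum (map (λ x → sum (map (f x) zs)) xs) * d ∎
  where open ≡.≡-Reasoning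

Σℤ-sub : ∀ (f g : A → ℤ) xs → Σℤ (map (λ x → f x - g x) xs) ≡ Σℤ (map f xs) - Σℤ (map g xs)
Σℤ-sub f g []       = ≡.refl
Σℤ-sub f g (x ∷ xs) = ≡.trans (≡.cong (λ s → f x - g x + s) (Σℤ-sub f g xs))
                              (regroup (f x) (g x) (Σℤ (map f xs)) (Σℤ (map g xs)))
  where
  regroup : ∀ a b S T → a - b + (S - T) ≡ a + S - (b + T)
  regroup = solve-∀

length-filter-sum : ∀ {p} {P : Pred A p} (P? : Decidable P) xs →
                    length (filter P? xs) ≡ sum (map (λ x → 𝟙 (does (P? x))) xs)
length-filter-sum P? []       = ≡.refl
length-filter-sum P? (x ∷ xs) with does (P? x)
... | true  = ≡.cong suc (length-filter-sum P? xs)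
... | false = length-filter-sum P? xs

≡-minus : ∀ {x y z} → x + y ≡ z → x ≡ z - y
≡-minus {x} {y} x+y≡z = ≡.trans (≡.sym (cancel x y)) (≡.cong (_- y) x+y≡z)
  where
  cancel : ∀ x y → x + y - y ≡ x
  cancel = solve-∀

esymTerm : ℤ → ℤ → ℕ → ℕ → ℕ → ℕ → ℤ
esymTerm X Y w u k j = X ^ j * Y ^ (k ∸ j) * + (w C j) * + (u C (k ∸ j))

-- The k-th elementary symmetric polynomial evaluated at w copies of X and u copies of Y.
esym : ℤ → ℤ → ℕ → ℕ → ℕ → ℤ
esym X Y w u k = Σℤ (map (esymTerm X Y w u k) (upTo (suc k)))

module _ where
  open ≡.≡-Reasoning

  private
    pos-Pascal : ∀ n k → + (suc n C suc k) ≡ + (n C k) + + (n C suc k)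
    pos-Pascal n k = ≡.trans (≡.cong +_ (≡.sym (nCk+nC[k+1]≡[n+1]C[k+1] n k))) (ℤP.pos-+ (n C k) (n C suc k))

  esym-sucˡ : ∀ X Y w u k → esym X Y (suc w) u (suc k) ≡ X * esym X Y w u k + esym X Y w u (suc k)
  esym-sucˡ X Y w u k = begin
    esym X Y (suc w) u (suc k)
      ≡⟨ ℤΣ.Σ-upTo-suc new (suc k) ⟩
    new 0 + Σℤ (map (new ∘ suc) (upTo (suc k)))
      ≡⟨ ≡.cong (λ s → new 0 + s) (ℤΣ.Σ-upTo-cong (suc k) (λ j _ → split j)) ⟩
    new 0 + Σℤ (map (λ j → X * old j + old′ (suc j)) (upTo (suc k)))
      ≡⟨ ≡.cong (λ s → new 0 + s) (≡.trans (ℤΣ.Σ-distrib-+ (λ j → X * old j) (old′ ∘ suc) (upTo (suc k)))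
                                      (≡.cong (_+ Σℤ (map (old′ ∘ suc) (upTo (suc k))))
                                              (ℤΣ.*-distribˡ-Σ X old (upTo (suc k))))) ⟩
    new 0 + (X * esym X Y w u k + Σℤ (map (old′ ∘ suc) (upTo (suc k))))
      ≡⟨ swap (new 0) (X * esym X Y w u k) _ ⟩
    X * esym X Y w u k + (old′ 0 + Σℤ (map (old′ ∘ suc) (upTo (suc k))))
      ≡⟨ ≡.cong (λ s → X * esym X Y w u k + s) (≡.sym (ℤΣ.Σ-upTo-suc old′ (suc k))) ⟩
    X * esym X Y w u k + esym X Y w u (suc k) ∎
    where
    new  = esymTerm X Y (suc w) u (suc k)
    old  = esymTerm X Y w u k
    old′ = esymTerm X Y w u (suc k)
    swap : ∀ a b c → a + (b + c) ≡ b + (a + c)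
    swap = solve-∀
    expand : ∀ X x y c c′ d → X * x * y * (c + c′) * d ≡ X * (x * y * c * d) + X * x * y * c′ * d
    expand = solve-∀
    split : ∀ j → new (suc j) ≡ X * old j + old′ (suc j)
    split j = ≡.trans (≡.cong (λ c → X * X ^ j * Y ^ (k ∸ j) * c * + (u C (k ∸ j))) (pos-Pascal w j))
                      (expand X (X ^ j) (Y ^ (k ∸ j)) (+ (w C j)) (+ (w C suc j)) (+ (u C (k ∸ j))))

  esym-sucʳ : ∀ X Y w u k → esym X Y w (suc u) (suc k) ≡ Y * esym X Y w u k + esym X Y w u (suc k)
  esym-sucʳ X Y w u k = begin
    esym X Y w (suc u) (suc k)
      ≡⟨ ℤΣ.Σ-upTo-sucʳ new (suc k) ⟩
    Σℤ (map new (upTo (suc k))) + new (suc k)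
      ≡⟨ ≡.cong₂ _+_ (ℤΣ.Σ-upTo-cong (suc k) split) top ⟩
    Σℤ (map (λ j → Y * old j + old′ j) (upTo (suc k))) + old′ (suc k)
      ≡⟨ ≡.cong (_+ old′ (suc k)) (≡.trans (ℤΣ.Σ-distrib-+ (λ j → Y * old j) old′ (upTo (suc k)))
                                             (≡.cong (_+ Σℤ (map old′ (upTo (suc k))))
                                                     (ℤΣ.*-distribˡ-Σ Y old (upTo (suc k))))) ⟩
    (Y * esym X Y w u k + Σℤ (map old′ (upTo (suc k)))) + old′ (suc k)
      ≡⟨ ℤP.+-assoc (Y * esym X Y w u k) _ _ ⟩
    Y * esym X Y w u k + (Σℤ (map old′ (upTo (suc k))) + old′ (suc k))
      ≡⟨ ≡.cong (λ s → Y * esym X Y w u k + s) (≡.sym (ℤΣ.Σ-upTo-sucʳ old′ (suc k))) ⟩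
    Y * esym X Y w u k + esym X Y w u (suc k) ∎
    where
    new  = esymTerm X Y w (suc u) (suc k)
    old  = esymTerm X Y w u k
    old′ = esymTerm X Y w u (suc k)
    expand : ∀ Y x y c d d′ → x * (Y * y) * c * (d + d′) ≡ Y * (x * y * c * d) + x * (Y * y) * c * d′
    expand = solve-∀
    split : ∀ j → j < suc k → new j ≡ Y * old j + old′ j
    split j (s≤s j≤k) rewrite ℕP.+-∸-assoc 1 j≤k =
      ≡.trans (≡.cong (λ d → X ^ j * (Y * Y ^ (k ∸ j)) * + (w C j) * d) (pos-Pascal u (k ∸ j)))
              (expand Y (X ^ j) (Y ^ (k ∸ j)) (+ (w C j)) (+ (u C (k ∸ j))) (+ (u C suc (k ∸ j))))
    top : new (suc k) ≡ old′ (suc k)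
    top rewrite ℕP.n∸n≡0 k = ≡.refl

  esym-noXˡ : ∀ X Y u k → esym X Y 0 u k ≡ Y ^ k * + (u C k)
  esym-noXˡ X Y u k = begin
    esym X Y 0 u k
      ≡⟨ ℤΣ.Σ-upTo-suc (esymTerm X Y 0 u k) k ⟩
    esymTerm X Y 0 u k 0 + Σℤ (map (esymTerm X Y 0 u k ∘ suc) (upTo k))
      ≡⟨ ≡.cong₂ _+_ (drop-ones (Y ^ k) (+ (u C k)))
                       (≡.trans (ℤΣ.Σ-upTo-cong k (λ j _ → vanishes j)) (ℤΣ.Σ-0 (upTo k))) ⟩
    Y ^ k * + (u C k) + + 0
      ≡⟨ ℤP.+-identityʳ _ ⟩
    Y ^ k * + (u C k) ∎
    where
    drop-ones : ∀ a b → + 1 * a * + 1 * b ≡ a * b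
    drop-ones = solve-∀
    vanishes : ∀ j → esymTerm X Y 0 u k (suc j) ≡ + 0
    vanishes j = ≡.trans (≡.cong (_* + (u C (k ∸ suc j))) (ℤP.*-zeroʳ (X ^ suc j * Y ^ (k ∸ suc j))))
                         (ℤP.*-zeroˡ (+ (u C (k ∸ suc j))))

  twoP-esym : ∀ p n w k →
    twoP (suc p) n w k ≡ esym (+ p) (+ p) w (n ∸ w) k - esym (- + 1) (+ p) w (n ∸ w) k
  twoP-esym p n w k =
    ≡.trans (ℤΣ.Σ-cong (λ j → distrib ((+ p) ^ j) ((- + 1) ^ j) ((+ p) ^ (k ∸ j))
                                      (+ (w C j)) (+ ((n ∸ w) C (k ∸ j))))
                       (upTo (suc k)))
            (Σℤ-sub (esymTerm (+ p) (+ p) w (n ∸ w) k) (esymTerm (- + 1) (+ p) w (n ∸ w) k) (upTo (suc k)))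
    where
    distrib : ∀ a b c d e → (a - b) * c * d * e ≡ a * c * d * e - b * c * d * e
    distrib = solve-∀

  esym-empty : ∀ X Y k → esym X Y 0 0 (suc k) ≡ + 0
  esym-empty X Y k = ≡.trans (esym-noXˡ X Y 0 (suc k)) (ℤP.*-zeroʳ (Y ^ suc k))

length-concatMap : ∀ (g : A → List B) xs → length (concatMap g xs) ≡ sum (map (length ∘ g) xs)
length-concatMap g xs =
  ≡.trans (length-as-sum (concatMap g xs))
          (≡.trans (ℕΣ.Σ-concatMap (λ _ → 1) g xs) (ℕΣ.Σ-cong (≡.sym ∘ length-as-sum ∘ g) xs))
  where
  length-as-sum : ∀ {ℓ} {C : Set ℓ} (ys : List C) → length ys ≡ sum (map (λ _ → 1) ys)
  length-as-sum ys = ≡.sym (≡.trans (sum-const 1 ys) (ℕP.*-identityʳ (length ys)))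

length-allFuns : ∀ k (xs : List A) → length (allFuns k xs) ≡ length xs ℕ.^ k
length-allFuns zero    xs = ≡.refl
length-allFuns (suc k) xs = begin
  length (concatMap (λ x → map (consF x) (allFuns k xs)) xs)
    ≡⟨ length-concatMap (λ x → map (consF x) (allFuns k xs)) xs ⟩
  sum (map (λ x → length (map (consF x) (allFuns k xs))) xs)
    ≡⟨ ℕΣ.Σ-cong (λ x → ListP.length-map (consF x) (allFuns k xs)) xs ⟩
  sum (map (λ _ → length (allFuns k xs)) xs)
    ≡⟨ sum-const (length (allFuns k xs)) xs ⟩
  length xs ℕ.* length (allFuns k xs)
    ≡⟨ ≡.cong (length xs ℕ.*_) (length-allFuns k xs) ⟩
  length xs ℕ.* length xs ℕ.^ k ∎
  where open ≡.≡-Reasoning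

∏-const : ∀ k x → ∏ {k} (λ _ → x) ≡ x ^ k
∏-const zero    x = ≡.refl
∏-const (suc k) x = ≡.cong (x *_) (∏-const k x)

count : ∀ {n} → (Fin n → Bool) → ℕ
count {n} s = sum (map (𝟙 ∘ s) (allFin n))

count-not : ∀ {n} (s : Fin n → Bool) → count (not ∘ s) ℕ.+ count s ≡ n
count-not {n} s = ≡.trans (go (allFin n)) (ListP.length-tabulate (λ i → i))
  where
  go : ∀ xs → sum (map (𝟙 ∘ not ∘ s) xs) ℕ.+ sum (map (𝟙 ∘ s) xs) ≡ length xs
  go []       = ≡.refl
  go (x ∷ xs) with s x
  ... | true  = ≡.trans (ℕP.+-suc _ _) (≡.cong suc (go xs))
  ... | false = ≡.cong suc (go xs)

module IncreasingProducts {n : ℕ} (g : Fin n → ℤ) where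
  open ≡.≡-Reasoning

  startsFrom : ∀ {k} → ℕ → (Fin k → Fin n) → Bool
  startsFrom {zero}  lo f = true
  startsFrom {suc k} lo f = does (lo ≤? toℕ (f fzero))

  increasingFromTerm : ∀ k → ℕ → (Fin k → Fin n) → ℤ
  increasingFromTerm k lo f = if startsFrom lo f ∧ increasing f then ∏ (g ∘ f) else + 0

  Σ-increasing-from : ℕ → ℕ → ℤ
  Σ-increasing-from k lo = Σℤ (map (increasingFromTerm k lo) (allFuns k (allFin n)))

  increasingFromTerm-consF : ∀ k lo x f →
    increasingFromTerm (suc k) lo (consF x f)
      ≡ (if does (lo ≤? toℕ x) then g x * increasingFromTerm k (suc (toℕ x)) f else + 0)
  increasingFromTerm-consF k lo x f with does (lo ≤? toℕ x) | k
  ... | false | _     = ≡.refl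
  ... | true  | zero  = ≡.refl
  ... | true  | suc _ with (toℕ x ℕ.<ᵇ toℕ (f fzero)) ∧ increasing f
  ...   | true  = ≡.refl
  ...   | false = ≡.sym (ℤP.*-zeroʳ (g x))

  Σ-increasing-from-suc : ∀ k lo →
    Σ-increasing-from (suc k) lo ≡ ℤΣ.Σ-from lo (λ x → g x * Σ-increasing-from k (suc (toℕ x)))
  Σ-increasing-from-suc k lo = begin
    Σ-increasing-from (suc k) lo
      ≡⟨ ℤΣ.Σ-concatMap (increasingFromTerm (suc k) lo) (λ x → map (consF x) fs) (allFin n) ⟩
    Σℤ (map (λ x → Σℤ (map (increasingFromTerm (suc k) lo) (map (consF x) fs))) (allFin n))
      ≡⟨ ℤΣ.Σ-cong (λ x → ≡.trans (ℤΣ.Σ-map (increasingFromTerm (suc k) lo) (consF x) fs)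
                                  (≡.trans (ℤΣ.Σ-cong (increasingFromTerm-consF k lo x) fs) (pull-out x)))
                   (allFin n) ⟩
    ℤΣ.Σ-from lo (λ x → g x * Σ-increasing-from k (suc (toℕ x))) ∎
    where
    fs = allFuns k (allFin n)
    pull-out : ∀ x → Σℤ (map (λ f → if does (lo ≤? toℕ x) then g x * increasingFromTerm k (suc (toℕ x)) f else + 0) fs)
                   ≡ (if does (lo ≤? toℕ x) then g x * Σ-increasing-from k (suc (toℕ x)) else + 0)
    pull-out x with does (lo ≤? toℕ x)
    ... | true  = ℤΣ.*-distribˡ-Σ (g x) (increasingFromTerm k (suc (toℕ x))) fs
    ... | false = ℤΣ.Σ-0 fs

  Σ-increasing-from-beyond : ∀ k lo → n ≤ lo → Σ-increasing-from (suc k) lo ≡ + 0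
  Σ-increasing-from-beyond k lo n≤lo =
    ≡.trans (Σ-increasing-from-suc k lo) (ℤΣ.Σ-from-beyond lo _ n≤lo)

  Σ-increasing-from-step : ∀ k lo (lo<n : lo < n) →
    Σ-increasing-from (suc k) lo
      ≡ g (fromℕ< lo<n) * Σ-increasing-from k (suc lo) + Σ-increasing-from (suc k) (suc lo)
  Σ-increasing-from-step k lo lo<n = begin
    Σ-increasing-from (suc k) lo
      ≡⟨ Σ-increasing-from-suc k lo ⟩
    ℤΣ.Σ-from lo (λ x → g x * Σ-increasing-from k (suc (toℕ x)))
      ≡⟨ ℤΣ.Σ-from-step lo _ lo<n ⟩
    g (fromℕ< lo<n) * Σ-increasing-from k (suc (toℕ (fromℕ< lo<n)))
      + ℤΣ.Σ-from (suc lo) (λ x → g x * Σ-increasing-from k (suc (toℕ x)))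
      ≡⟨ ≡.cong₂ (λ i s → g (fromℕ< lo<n) * Σ-increasing-from k (suc i) + s)
                 (FinP.toℕ-fromℕ< lo<n) (≡.sym (Σ-increasing-from-suc k (suc lo))) ⟩
    g (fromℕ< lo<n) * Σ-increasing-from k (suc lo) + Σ-increasing-from (suc k) (suc lo) ∎

  module TwoValued (s : Fin n → Bool) (X Y : ℤ) (g-two : ∀ i → g i ≡ (if s i then X else Y)) where

    Σ-increasing-from-esym : ∀ d lo → lo ℕ.+ d ≡ n → ∀ k →
      Σ-increasing-from k lo ≡ esym X Y (ℕΣ.Σ-from lo (𝟙 ∘ s)) (ℕΣ.Σ-from lo (𝟙 ∘ not ∘ s)) k
    Σ-increasing-from-esym d       lo eq zero    = ≡.refl
    Σ-increasing-from-esym zero    lo eq (suc k) = begin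
      Σ-increasing-from (suc k) lo
        ≡⟨ Σ-increasing-from-beyond k lo n≤lo ⟩
      + 0
        ≡⟨ esym-empty X Y k ⟨
      esym X Y 0 0 (suc k)
        ≡⟨ ≡.cong₂ (λ w u → esym X Y w u (suc k))
                   (ℕΣ.Σ-from-beyond lo (𝟙 ∘ s) n≤lo) (ℕΣ.Σ-from-beyond lo (𝟙 ∘ not ∘ s) n≤lo) ⟨
      esym X Y (ℕΣ.Σ-from lo (𝟙 ∘ s)) (ℕΣ.Σ-from lo (𝟙 ∘ not ∘ s)) (suc k) ∎
      where
      n≤lo : n ≤ lo
      n≤lo = ℕP.≤-reflexive (≡.trans (≡.sym eq) (ℕP.+-identityʳ lo))
    Σ-increasing-from-esym (suc d) lo eq (suc k) = begin
      Σ-increasing-from (suc k) lo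
        ≡⟨ Σ-increasing-from-step k lo lo<n ⟩
      g x₀ * Σ-increasing-from k (suc lo) + Σ-increasing-from (suc k) (suc lo)
        ≡⟨ ≡.cong₂ (λ a b → g x₀ * a + b) (Σ-increasing-from-esym d (suc lo) eq′ k)
                                           (Σ-increasing-from-esym d (suc lo) eq′ (suc k)) ⟩
      g x₀ * esym X Y w′ u′ k + esym X Y w′ u′ (suc k)
        ≡⟨ pascal (s x₀) ≡.refl ⟩
      esym X Y (ℕΣ.Σ-from lo (𝟙 ∘ s)) (ℕΣ.Σ-from lo (𝟙 ∘ not ∘ s)) (suc k) ∎
      where
      eq′ : suc lo ℕ.+ d ≡ n
      eq′ = ≡.trans (≡.sym (ℕP.+-suc lo d)) eq
      lo<n : lo < n
      lo<n = ℕP.≤-trans (ℕP.m≤m+n (suc lo) d) (ℕP.≤-reflexive eq′)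
      x₀ = fromℕ< lo<n
      w′ = ℕΣ.Σ-from (suc lo) (𝟙 ∘ s)
      u′ = ℕΣ.Σ-from (suc lo) (𝟙 ∘ not ∘ s)
      pascal : ∀ b → s x₀ ≡ b →
               g x₀ * esym X Y w′ u′ k + esym X Y w′ u′ (suc k)
                 ≡ esym X Y (ℕΣ.Σ-from lo (𝟙 ∘ s)) (ℕΣ.Σ-from lo (𝟙 ∘ not ∘ s)) (suc k)
      pascal b sx₀≡b
        rewrite ℕΣ.Σ-from-step lo (𝟙 ∘ s) lo<n | ℕΣ.Σ-from-step lo (𝟙 ∘ not ∘ s) lo<n | g-two x₀ | sx₀≡b
        with b
      ... | true  = ≡.sym (esym-sucˡ X Y w′ u′ k)
      ... | false = ≡.sym (esym-sucʳ X Y w′ u′ k)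

    Σ-∏-increasing : ∀ k →
      Σℤ (map (λ f → ∏ (g ∘ f)) (increasingSeqs k n)) ≡ esym X Y (count s) (n ∸ count s) k
    Σ-∏-increasing k = begin
      Σℤ (map (λ f → ∏ (g ∘ f)) (increasingSeqs k n))
        ≡⟨ ℤΣ.Σ-filter (λ f → T? (increasing f)) (λ f → ∏ (g ∘ f)) (allFuns k (allFin n)) ⟩
      Σℤ (map (λ f → if increasing f then ∏ (g ∘ f) else + 0) (allFuns k (allFin n)))
        ≡⟨ ℤΣ.Σ-cong (λ f → ≡.cong (λ b → if b ∧ increasing f then ∏ (g ∘ f) else + 0)
                                    (≡.sym (startsFrom-0 f))) (allFuns k (allFin n)) ⟩
      Σ-increasing-from k 0
        ≡⟨ Σ-increasing-from-esym n 0 ≡.refl k ⟩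
      esym X Y (count s) (count (not ∘ s)) k
        ≡⟨ ≡.cong (λ u → esym X Y (count s) u k)
                  (≡.trans (≡.sym (ℕP.m+n∸n≡m (count (not ∘ s)) (count s)))
                           (≡.cong (ℕ._∸ count s) (count-not s))) ⟩
      esym X Y (count s) (n ∸ count s) k ∎
      where
      startsFrom-0 : ∀ {k} (f : Fin k → Fin n) → startsFrom 0 f ≡ true
      startsFrom-0 {zero}  f = ≡.refl
      startsFrom-0 {suc k} f = ≡.refl

length-increasingSeqs : ∀ k n → length (increasingSeqs k n) ≡ n C k
length-increasingSeqs k n = ℤP.+-injective (begin
  + length Is
    ≡⟨ ℤP.*-identityʳ (+ length Is) ⟨
  + length Is * + 1
    ≡⟨ Σℤ-const (+ 1) Is ⟨
  Σℤ (map (λ _ → + 1) Is)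
    ≡⟨ ℤΣ.Σ-cong (λ _ → ≡.trans (∏-const k (+ 1)) (ℤP.^-zeroˡ k)) Is ⟨
  Σℤ (map (λ f → ∏ (one ∘ f)) Is)
    ≡⟨ IncreasingProducts.TwoValued.Σ-∏-increasing one (λ _ → false) (+ 1) (+ 1) (λ _ → ≡.refl) k ⟩
  esym (+ 1) (+ 1) none (n ∸ none) k
    ≡⟨ ≡.cong (λ w → esym (+ 1) (+ 1) w (n ∸ w) k) (ℕΣ.Σ-0 (allFin n)) ⟩
  esym (+ 1) (+ 1) 0 n k
    ≡⟨ esym-noXˡ (+ 1) (+ 1) n k ⟩
  (+ 1) ^ k * + (n C k)
    ≡⟨ ≡.trans (≡.cong (_* + (n C k)) (ℤP.^-zeroˡ k)) (ℤP.*-identityˡ (+ (n C k))) ⟩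
  + (n C k) ∎)
  where
  open ≡.≡-Reasoning
  Is = increasingSeqs k n
  one : Fin n → ℤ
  one _ = + 1
  none = count {n} (λ _ → false)

module FieldCounting {c ℓ} {p : ℕ} (F : FiniteField c ℓ (suc p)) where
  private module F = FiniteField F
  open F using (Carrier; _≈_; 0#; 1#; ω)
  open FieldFacts F
  open ≡.≡-Reasoning

  ν : Carrier → ℤ
  ν y = if isZero y then + p else - + 1

  ν-cong : ∀ {x y} → x ≈ y → ν x ≡ ν y
  ν-cong x≈y = ≡.cong (λ b → if b then + p else - + 1) (isZero-cong x≈y)

  ν-indicator : ∀ y → ν y ≡ - + 1 + + 𝟙 (isZero y) * + suc p
  ν-indicator y with isZero y
  ... | true  = shift (+ p)
    where
    shift : ∀ P → P ≡ - + 1 + + 1 * (+ 1 + P)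
    shift = solve-∀
  ... | false = ≡.refl

  ω-zero-unique : ∀ i → isZero (ω i) ≡ true → i ≡ fzero
  ω-zero-unique i ωi≈0 = F.ω-inj i fzero (F.trans (isZero-true⁻ ωi≈0) (F.sym (F.ω-first fzero ≡.refl)))

  length-nonzeros : length (nonzeros F) ≡ p
  length-nonzeros = ℕP.+-cancelʳ-≡ 1 _ _ (begin
    length (nonzeros F) ℕ.+ 1
      ≡⟨ ≡.cong₂ ℕ._+_ (≡.trans (length-filter-sum (λ x → ¬? (x F.≟ 0#)) (map ω (allFin (suc p))))
                                (ℕΣ.Σ-map (λ x → 𝟙 (not (isZero x))) ω (allFin (suc p))))
                       (≡.sym (ℕΣ.Σ-unique (isZero ∘ ω) (λ _ → 1) (isZero-true (F.ω-first fzero ≡.refl))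
                                            ω-zero-unique)) ⟩
    count (not ∘ isZero ∘ ω) ℕ.+ count (isZero ∘ ω)  ≡⟨ count-not (isZero ∘ ω) ⟩
    suc p                                            ≡⟨ ℕP.+-comm 1 p ⟩
    p ℕ.+ 1                                          ∎)

  roots-affine : ∀ e {b b⁻¹} → b F.* b⁻¹ ≈ 1# →
                 sum (map (λ x → 𝟙 (isZero (e F.+ x F.* b))) (nonzeros F)) ≡ 𝟙 (not (isZero e))
  roots-affine e {b} {b⁻¹} bb⁻¹≈1 = begin
    sum (map isRootᶠ (nonzeros F))
      ≡⟨ ℕΣ.Σ-filter (λ x → ¬? (x F.≟ 0#)) isRootᶠ (map ω (allFin (suc p))) ⟩
    sum (map (λ x → if not (isZero x) then isRootᶠ x else 0) (map ω (allFin (suc p))))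
      ≡⟨ ℕΣ.Σ-map (λ x → if not (isZero x) then isRootᶠ x else 0) ω (allFin (suc p)) ⟩
    sum (map (λ i → if not (isZero (ω i)) then isRootᶠ (ω i) else 0) (allFin (suc p)))
      ≡⟨ ℕΣ.Σ-cong (λ i → if-𝟙 (not (isZero (ω i))) (isZero (e F.+ ω i F.* b))) (allFin (suc p)) ⟩
    count isRoot
      ≡⟨ count-roots (isZero e) ≡.refl ⟩
    𝟙 (not (isZero e)) ∎
    where
    isRootᶠ : Carrier → ℕ
    isRootᶠ x = 𝟙 (isZero (e F.+ x F.* b))
    isRoot : Fin (suc p) → Bool
    isRoot i = not (isZero (ω i)) ∧ isZero (e F.+ ω i F.* b)
    if-𝟙 : ∀ a b → (if a then 𝟙 b else 0) ≡ 𝟙 (a ∧ b)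
    if-𝟙 true  b = ≡.refl
    if-𝟙 false b = ≡.refl
    count-roots : ∀ z → isZero e ≡ z → count isRoot ≡ 𝟙 (not z)
    count-roots true e≈0 = ≡.trans (ℕΣ.Σ-cong no-root (allFin (suc p))) (ℕΣ.Σ-0 (allFin (suc p)))
      where
      no-root : ∀ i → 𝟙 (isRoot i) ≡ 0
      no-root i with isZero (ω i) in ωi≟0
      ... | true  = ≡.refl
      ... | false = ≡.cong 𝟙 (isZero-false λ e+ωib≈0 →
        *-nonzero bb⁻¹≈1 (isZero-false⁻ ωi≟0)
          (F.trans (F.sym (F.trans (F.+-congʳ (isZero-true⁻ e≈0)) (F.+-identityˡ _))) e+ωib≈0))
    count-roots false e≉0 = ℕΣ.Σ-unique isRoot (λ _ → 1) isRoot-i₀ unique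
      where
      root = (F.- e) F.* b⁻¹
      i₀ = proj₁ (F.ω-surj root)
      ωi₀≈root : ω i₀ ≈ root
      ωi₀≈root = proj₂ (F.ω-surj root)
      e+ωi₀b≈0 : e F.+ ω i₀ F.* b ≈ 0#
      e+ωi₀b≈0 = F.trans (F.+-congˡ (F.*-congʳ ωi₀≈root)) (root-exists bb⁻¹≈1)
      ωi₀≉0 : isZero (ω i₀) ≡ false
      ωi₀≉0 = isZero-false λ ωi₀≈0 → isZero-false⁻ e≉0
        (F.trans (F.sym (F.+-identityʳ e))
                 (F.trans (F.+-congˡ (F.sym (F.trans (F.*-congʳ ωi₀≈0) (F.zeroˡ b)))) e+ωi₀b≈0))
      isRoot-i₀ : isRoot i₀ ≡ true
      isRoot-i₀ rewrite ωi₀≉0 = isZero-true e+ωi₀b≈0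
      unique : ∀ i → isRoot i ≡ true → i ≡ i₀
      unique i isRoot-i with isZero (ω i)
      ... | false = F.ω-inj i i₀ (F.trans (root-unique bb⁻¹≈1 (isZero-true⁻ isRoot-i)) (F.sym ωi₀≈root))

  Σ-ν-affine : ∀ e b → Σℤ (map (λ x → ν (e F.+ x F.* b)) (nonzeros F)) ≡ ν e * ν b
  Σ-ν-affine e b with b F.≟ 0#
  ... | yes b≈0 = begin
    Σℤ (map (λ x → ν (e F.+ x F.* b)) (nonzeros F))  ≡⟨ ℤΣ.Σ-cong (λ x → ν-cong (absorb x)) (nonzeros F) ⟩
    Σℤ (map (λ _ → ν e) (nonzeros F))                ≡⟨ Σℤ-const (ν e) (nonzeros F) ⟩
    + length (nonzeros F) * ν e                      ≡⟨ ≡.cong (λ l → + l * ν e) length-nonzeros ⟩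
    + p * ν e                                        ≡⟨ ℤP.*-comm (+ p) (ν e) ⟩
    ν e * + p                                        ∎
    where
    absorb : ∀ x → e F.+ x F.* b ≈ e
    absorb x = F.trans (F.+-congˡ (F.trans (F.*-congˡ b≈0) (F.zeroʳ x))) (F.+-identityʳ e)
  ... | no b≉0 = begin
    Σℤ (map (λ x → ν (e F.+ x F.* b)) (nonzeros F))
      ≡⟨ ℤΣ.Σ-cong (λ x → ν-indicator (e F.+ x F.* b)) (nonzeros F) ⟩
    Σℤ (map (λ x → - + 1 + vanishes x * + suc p) (nonzeros F))
      ≡⟨ Σℤ-affine (- + 1) vanishes (+ suc p) (nonzeros F) ⟩
    + length (nonzeros F) * - + 1 + Σℤ (map vanishes (nonzeros F)) * + suc p
      ≡⟨ ≡.cong₂ (λ l s → + l * - + 1 + s * + suc p) length-nonzeros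
                 (≡.trans (≡.sym (pos-sum (λ x → 𝟙 (isZero (e F.+ x F.* b))) (nonzeros F)))
                          (≡.cong +_ (roots-affine e (proj₂ (F.inverse b b≉0))))) ⟩
    + p * - + 1 + + 𝟙 (not (isZero e)) * + suc p
      ≡⟨ by-cases (isZero e) ⟩
    ν e * - + 1 ∎
    where
    vanishes : Carrier → ℤ
    vanishes x = + 𝟙 (isZero (e F.+ x F.* b))
    by-cases : ∀ z → + p * - + 1 + + 𝟙 (not z) * + suc p ≡ (if z then + p else - + 1) * - + 1
    by-cases true  = ℤP.+-identityʳ (+ p * - + 1)
    by-cases false = cancel (+ p)
      where
      cancel : ∀ P → P * - + 1 + + 1 * (+ 1 + P) ≡ - + 1 * - + 1
      cancel = solve-∀

  nonzeroCount : ∀ k → (Fin k → Carrier) → Carrier → ℕ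
  nonzeroCount k b e =
    sum (map (λ α → 𝟙 (not (isZero (e F.+ fsum F k (λ t → α t F.* b t))))) (allFuns k (nonzeros F)))

  nonzeroCount-suc : ∀ k b e →
    nonzeroCount (suc k) b e ≡ sum (map (λ x → nonzeroCount k (b ∘ fsuc) (e F.+ x F.* b fzero)) (nonzeros F))
  nonzeroCount-suc k b e =
    ≡.trans (ℕΣ.Σ-concatMap term (λ x → map (consF x) (allFuns k (nonzeros F))) (nonzeros F))
            (ℕΣ.Σ-cong (λ x → ≡.trans (ℕΣ.Σ-map term (consF x) (allFuns k (nonzeros F)))
                                      (ℕΣ.Σ-cong (λ α → ≡.cong (𝟙 ∘ not) (isZero-cong (F.sym (F.+-assoc e _ _))))
                                                 (allFuns k (nonzeros F))))
                       (nonzeros F))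
    where
    term : (Fin (suc k) → Carrier) → ℕ
    term α = 𝟙 (not (isZero (e F.+ fsum F (suc k) (λ t → α t F.* b t))))

  -- Fixing the first coefficient x ∈ F^* shifts e to e + x·b₀, and summing ν over x multiplies by ν b₀.
  nonzeroCount-formula : ∀ k b e → + suc p * + nonzeroCount k b e ≡ (+ p) ^ suc k - ν e * ∏ (ν ∘ b)
  nonzeroCount-formula zero b e
    rewrite isZero-cong (F.+-identityʳ e) with isZero e
  ... | true  = empty (+ p)
    where
    empty : ∀ P → (+ 1 + P) * + 0 ≡ P * + 1 - P * + 1
    empty = solve-∀
  ... | false = single (+ p)
    where
    single : ∀ P → (+ 1 + P) * + 1 ≡ P * + 1 - - + 1 * + 1
    single = solve-∀
  nonzeroCount-formula (suc k) b e = begin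
    + suc p * + nonzeroCount (suc k) b e
      ≡⟨ ≡.cong (λ n → + suc p * + n) (nonzeroCount-suc k b e) ⟩
    + suc p * + sum (map (λ x → nonzeroCount k (b ∘ fsuc) (shift x)) (nonzeros F))
      ≡⟨ ≡.cong (+ suc p *_) (pos-sum (λ x → nonzeroCount k (b ∘ fsuc) (shift x)) (nonzeros F)) ⟩
    + suc p * Σℤ (map (λ x → + nonzeroCount k (b ∘ fsuc) (shift x)) (nonzeros F))
      ≡⟨ ℤΣ.*-distribˡ-Σ (+ suc p) (λ x → + nonzeroCount k (b ∘ fsuc) (shift x)) (nonzeros F) ⟨
    Σℤ (map (λ x → + suc p * + nonzeroCount k (b ∘ fsuc) (shift x)) (nonzeros F))
      ≡⟨ ℤΣ.Σ-cong (λ x → ≡.trans (nonzeroCount-formula k (b ∘ fsuc) (shift x))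
                                  (negate-right ((+ p) ^ suc k) (ν (shift x)) Π))
                   (nonzeros F) ⟩
    Σℤ (map (λ x → (+ p) ^ suc k + ν (shift x) * - Π) (nonzeros F))
      ≡⟨ Σℤ-affine ((+ p) ^ suc k) (ν ∘ shift) (- Π) (nonzeros F) ⟩
    + length (nonzeros F) * (+ p) ^ suc k + Σℤ (map (ν ∘ shift) (nonzeros F)) * - Π
      ≡⟨ ≡.cong₂ (λ l s → + l * (+ p) ^ suc k + s * - Π) length-nonzeros (Σ-ν-affine e (b fzero)) ⟩
    + p * (+ p) ^ suc k + ν e * ν (b fzero) * - Π
      ≡⟨ regroup (+ p * (+ p) ^ suc k) (ν e) (ν (b fzero)) Π ⟩
    (+ p) ^ suc (suc k) - ν e * ∏ (ν ∘ b) ∎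
    where
    shift : Carrier → Carrier
    shift x = e F.+ x F.* b fzero
    Π = ∏ (ν ∘ b ∘ fsuc)
    negate-right : ∀ a y z → a - y * z ≡ a + y * - z
    negate-right = solve-∀
    regroup : ∀ a x y z → a + x * y * - z ≡ a - x * (y * z)
    regroup = solve-∀

  module _ {M n : ℕ} (code : Fin M → Fin n → Carrier) (k : ℕ) where

    Σ-row-nonzeroCount : ∀ w r → weight F (code r) ≡ w →
      Σℤ (map (λ idx → + suc p * + nonzeroCount k (code r ∘ idx) 0#) (increasingSeqs k n))
        ≡ + p * twoP (suc p) n w k
    Σ-row-nonzeroCount w r weight≡w = begin
      Σℤ (map (λ idx → + suc p * + nonzeroCount k (code r ∘ idx) 0#) Is)
        ≡⟨ ℤΣ.Σ-cong (λ idx → ≡.trans (nonzeroCount-formula k (code r ∘ idx) 0#) (split idx)) Is ⟩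
      Σℤ (map (λ idx → + p * (∏ (constant ∘ idx) - ∏ (ν ∘ code r ∘ idx))) Is)
        ≡⟨ ℤΣ.*-distribˡ-Σ (+ p) (λ idx → ∏ (constant ∘ idx) - ∏ (ν ∘ code r ∘ idx)) Is ⟩
      + p * Σℤ (map (λ idx → ∏ (constant ∘ idx) - ∏ (ν ∘ code r ∘ idx)) Is)
        ≡⟨ ≡.cong (+ p *_) (Σℤ-sub (λ idx → ∏ (constant ∘ idx)) (λ idx → ∏ (ν ∘ code r ∘ idx)) Is) ⟩
      + p * (Σℤ (map (λ idx → ∏ (constant ∘ idx)) Is)
             - Σℤ (map (λ idx → ∏ (ν ∘ code r ∘ idx)) Is))
        ≡⟨ ≡.cong₂ (λ a b → + p * (a - b))
                   (IncreasingProducts.TwoValued.Σ-∏-increasing constant nonzeroAt (+ p) (+ p) constant-two k)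
                   (IncreasingProducts.TwoValued.Σ-∏-increasing (ν ∘ code r) nonzeroAt (- + 1) (+ p) ν-two k) ⟩
      + p * (esym (+ p) (+ p) (count nonzeroAt) (n ∸ count nonzeroAt) k
             - esym (- + 1) (+ p) (count nonzeroAt) (n ∸ count nonzeroAt) k)
        ≡⟨ ≡.cong (λ w → + p * (esym (+ p) (+ p) w (n ∸ w) k - esym (- + 1) (+ p) w (n ∸ w) k))
                  (≡.trans (≡.sym (length-filter-sum (λ i → ¬? (code r i F.≟ 0#)) (allFin n))) weight≡w) ⟩
      + p * (esym (+ p) (+ p) w (n ∸ w) k - esym (- + 1) (+ p) w (n ∸ w) k)
        ≡⟨ ≡.cong (+ p *_) (twoP-esym p n w k) ⟨
      + p * twoP (suc p) n w k ∎
      where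
      Is = increasingSeqs k n
      constant : Fin n → ℤ
      constant _ = + p
      nonzeroAt : Fin n → Bool
      nonzeroAt i = not (isZero (code r i))
      constant-two : ∀ i → constant i ≡ (if nonzeroAt i then + p else + p)
      constant-two i with nonzeroAt i
      ... | true  = ≡.refl
      ... | false = ≡.refl
      ν-two : ∀ i → ν (code r i) ≡ (if nonzeroAt i then - + 1 else + p)
      ν-two i with isZero (code r i)
      ... | true  = ≡.refl
      ... | false = ≡.refl
      split : ∀ (idx : Fin k → Fin n) →
              (+ p) ^ suc k - ν 0# * ∏ (ν ∘ code r ∘ idx) ≡ + p * (∏ (constant ∘ idx) - ∏ (ν ∘ code r ∘ idx))
      split idx rewrite isZero-true (F.refl {0#}) | ∏-const k (+ p) =
        factor (+ p) ((+ p) ^ k) (∏ (ν ∘ code r ∘ idx))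
        where
        factor : ∀ P a b → P * a - P * b ≡ P * (a - b)
        factor = solve-∀

    totalWeight : ℕ
    totalWeight = sum (map (λ α → sum (map (λ idx → weight F (combo F code α idx)) (increasingSeqs k n)))
                           (allFuns k (nonzeros F)))

    totalWeight-by-rows : totalWeight ≡
      sum (map (λ r → sum (map (λ idx → nonzeroCount k (code r ∘ idx) 0#) (increasingSeqs k n))) (allFin M))
    totalWeight-by-rows = begin
      totalWeight
        ≡⟨ ℕΣ.Σ-cong (λ α → ℕΣ.Σ-cong (λ idx → length-filter-sum _ (allFin M)) Is) As ⟩
      sum (map (λ α → sum (map (λ idx → sum (map (nz α idx) (allFin M))) Is)) As)
        ≡⟨ ℕΣ.Σ-cong (λ α → ℕΣ.Σ-swap (nz α) Is (allFin M)) As ⟩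
      sum (map (λ α → sum (map (λ r → sum (map (λ idx → nz α idx r) Is)) (allFin M))) As)
        ≡⟨ ℕΣ.Σ-swap (λ α r → sum (map (λ idx → nz α idx r) Is)) As (allFin M) ⟩
      sum (map (λ r → sum (map (λ α → sum (map (λ idx → nz α idx r) Is)) As)) (allFin M))
        ≡⟨ ℕΣ.Σ-cong (λ r → ℕΣ.Σ-swap (λ α idx → nz α idx r) As Is) (allFin M) ⟩
      sum (map (λ r → sum (map (λ idx → sum (map (λ α → nz α idx r) As)) Is)) (allFin M))
        ≡⟨ ℕΣ.Σ-cong (λ r → ℕΣ.Σ-cong (λ idx → ℕΣ.Σ-cong (λ α → drop-0+ (combo F code α idx r)) As) Is) (allFin M) ⟩
      sum (map (λ r → sum (map (λ idx → nonzeroCount k (code r ∘ idx) 0#) Is)) (allFin M)) ∎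
      where
      As = allFuns k (nonzeros F)
      Is = increasingSeqs k n
      nz : (Fin k → Carrier) → (Fin k → Fin n) → Fin M → ℕ
      nz α idx r = 𝟙 (not (isZero (combo F code α idx r)))
      drop-0+ : ∀ x → 𝟙 (not (isZero x)) ≡ 𝟙 (not (isZero (0# F.+ x)))
      drop-0+ x = ≡.cong (𝟙 ∘ not) (isZero-cong (F.sym (F.+-identityˡ x)))

    totalWeight-formula : ∀ w → (∀ r → weight F (code r) ≡ w) →
      + suc p * + totalWeight ≡ + M * (+ p * twoP (suc p) n w k)
    totalWeight-formula w weight≡w = begin
      + suc p * + totalWeight
        ≡⟨ ≡.cong (λ t → + suc p * + t) totalWeight-by-rows ⟩
      + suc p * + sum (map rowCount (allFin M))
        ≡⟨ ≡.cong (+ suc p *_) (pos-sum rowCount (allFin M)) ⟩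
      + suc p * Σℤ (map (+_ ∘ rowCount) (allFin M))
        ≡⟨ ℤΣ.*-distribˡ-Σ (+ suc p) (+_ ∘ rowCount) (allFin M) ⟨
      Σℤ (map (λ r → + suc p * + rowCount r) (allFin M))
        ≡⟨ ℤΣ.Σ-cong (λ r → ≡.trans (≡.cong (+ suc p *_) (pos-sum (λ idx → nonzeroCount k (code r ∘ idx) 0#) Is))
                                    (≡.trans (≡.sym (ℤΣ.*-distribˡ-Σ (+ suc p) _ Is))
                                             (Σ-row-nonzeroCount w r (weight≡w r))))
                     (allFin M) ⟩
      Σℤ (map (λ _ → + p * twoP (suc p) n w k) (allFin M))
        ≡⟨ Σℤ-const (+ p * twoP (suc p) n w k) (allFin M) ⟩
      + length (allFin M) * (+ p * twoP (suc p) n w k)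
        ≡⟨ ≡.cong (λ l → + l * (+ p * twoP (suc p) n w k)) (ListP.length-tabulate {n = M} (λ i → i)) ⟩
      + M * (+ p * twoP (suc p) n w k) ∎
      where
      Is = increasingSeqs k n
      rowCount : Fin M → ℕ
      rowCount r = sum (map (λ idx → nonzeroCount k (code r ∘ idx) 0#) Is)

module PairProducts {n : ℕ} (y : Fin n → ℕ) where
  open ≡.≡-Reasoning

  ΣΣ : (Fin n → Fin n → ℕ) → ℕ
  ΣΣ f = sum (map (λ c → sum (map (f c) (allFin n))) (allFin n))

  below above diagonal : Fin n → Fin n → ℕ
  below    c d = if toℕ c ℕ.<ᵇ toℕ d then y c ℕ.* y d else 0
  above    c d = if toℕ d ℕ.<ᵇ toℕ c then y c ℕ.* y d else 0
  diagonal c d = if does (c Fin.≟ d) then y c ℕ.* y d else 0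

  ΣΣ-distrib-+ : ∀ f g → ΣΣ (λ c d → f c d ℕ.+ g c d) ≡ ΣΣ f ℕ.+ ΣΣ g
  ΣΣ-distrib-+ f g = ≡.trans (ℕΣ.Σ-cong (λ c → ℕΣ.Σ-distrib-+ (f c) (g c) (allFin n)) (allFin n))
                             (ℕΣ.Σ-distrib-+ (λ c → sum (map (f c) (allFin n))) (λ c → sum (map (g c) (allFin n))) (allFin n))

  private
    <ᵇ-true : ∀ {m n} → m < n → (m ℕ.<ᵇ n) ≡ true
    <ᵇ-true {m} {n} = dec-true (m ℕP.<? n)
    <ᵇ-false : ∀ {m n} → ¬ m < n → (m ℕ.<ᵇ n) ≡ false
    <ᵇ-false {m} {n} = dec-false (m ℕP.<? n)

  trichotomy : ∀ c d → y c ℕ.* y d ≡ below c d ℕ.+ above c d ℕ.+ diagonal c d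
  trichotomy c d with ℕP.<-cmp (toℕ c) (toℕ d)
  ... | tri< c<d c≢d _
    rewrite <ᵇ-true c<d | <ᵇ-false (ℕP.<⇒≯ c<d) | dec-false (c Fin.≟ d) (c≢d ∘ ≡.cong toℕ)
    = ≡.sym (≡.trans (ℕP.+-identityʳ _) (ℕP.+-identityʳ _))
  ... | tri≈ _ c≡d _
    rewrite <ᵇ-false (ℕP.<-irrefl c≡d) | <ᵇ-false (ℕP.<-irrefl (≡.sym c≡d))
          | dec-true (c Fin.≟ d) (FinP.toℕ-injective c≡d)
    = ≡.refl
  ... | tri> _ c≢d d<c
    rewrite <ᵇ-false (ℕP.<⇒≯ d<c) | <ᵇ-true d<c | dec-false (c Fin.≟ d) (c≢d ∘ ≡.cong toℕ)
    = ≡.sym (ℕP.+-identityʳ _)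

  Σ-square : sum (map y (allFin n)) ℕ.* sum (map y (allFin n)) ≡ ΣΣ (λ c d → y c ℕ.* y d)
  Σ-square = begin
    Y ℕ.* Y                                       ≡⟨ ℕΣ.*-distribˡ-Σ Y y (allFin n) ⟨
    sum (map (λ c → Y ℕ.* y c) (allFin n))        ≡⟨ ℕΣ.Σ-cong (λ c → ≡.trans (ℕP.*-comm Y (y c))
                                                       (≡.sym (ℕΣ.*-distribˡ-Σ (y c) y (allFin n)))) (allFin n) ⟩
    ΣΣ (λ c d → y c ℕ.* y d)                      ∎
    where Y = sum (map y (allFin n))

  pairs-identity : 2 ℕ.* ΣΣ below ℕ.+ sum (map (λ c → y c ℕ.* y c) (allFin n))
                     ≡ sum (map y (allFin n)) ℕ.* sum (map y (allFin n))
  pairs-identity = begin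
    2 ℕ.* ΣΣ below ℕ.+ sum (map (λ c → y c ℕ.* y c) (allFin n))
      ≡⟨ ≡.cong₂ ℕ._+_ (≡.cong (ΣΣ below ℕ.+_) (≡.trans (ℕP.+-identityʳ (ΣΣ below)) (≡.sym above≡below)))
                       (≡.sym diagonal≡squares) ⟩
    ΣΣ below ℕ.+ ΣΣ above ℕ.+ ΣΣ diagonal
      ≡⟨ ≡.cong (ℕ._+ ΣΣ diagonal) (≡.sym (ΣΣ-distrib-+ below above)) ⟩
    ΣΣ (λ c d → below c d ℕ.+ above c d) ℕ.+ ΣΣ diagonal
      ≡⟨ ≡.sym (ΣΣ-distrib-+ (λ c d → below c d ℕ.+ above c d) diagonal) ⟩
    ΣΣ (λ c d → below c d ℕ.+ above c d ℕ.+ diagonal c d)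
      ≡⟨ ℕΣ.Σ-cong (λ c → ℕΣ.Σ-cong (λ d → ≡.sym (trichotomy c d)) (allFin n)) (allFin n) ⟩
    ΣΣ (λ c d → y c ℕ.* y d)
      ≡⟨ Σ-square ⟨
    sum (map y (allFin n)) ℕ.* sum (map y (allFin n)) ∎
    where
    above≡below : ΣΣ above ≡ ΣΣ below
    above≡below = ≡.trans (ℕΣ.Σ-swap above (allFin n) (allFin n))
                          (ℕΣ.Σ-cong (λ c → ℕΣ.Σ-cong (λ d → transpose c d) (allFin n)) (allFin n))
      where
      transpose : ∀ c d → above d c ≡ below c d
      transpose c d with toℕ c ℕ.<ᵇ toℕ d
      ... | true  = ℕP.*-comm (y d) (y c)
      ... | false = ≡.refl
    diagonal≡squares : ΣΣ diagonal ≡ sum (map (λ c → y c ℕ.* y c) (allFin n))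
    diagonal≡squares = ℕΣ.Σ-cong (λ c → ℕΣ.Σ-unique (λ d → does (c Fin.≟ d)) (λ d → y c ℕ.* y d)
                                                     (dec-true (c Fin.≟ c) ≡.refl) (λ d → ≡.sym ∘ decided (c Fin.≟ d)))
                                 (allFin n)

NonNeg : ℤ → Set
NonNeg a = + 0 ℤ.≤ a

nonneg-pos : ∀ n → NonNeg (+ n)
nonneg-pos n = ℤ.+≤+ z≤n

nonneg-+ : ∀ {a b} → NonNeg a → NonNeg b → NonNeg (a + b)
nonneg-+ = ℤP.+-mono-≤

nonneg-* : ∀ {a b} → NonNeg a → NonNeg b → NonNeg (a * b)
nonneg-* {+ m} {+ n} _ _ = ≡.subst NonNeg (ℤP.pos-* m n) (nonneg-pos (m ℕ.* n))

≤-by-difference : ∀ {a b} d → NonNeg d → b ≡ a + d → a ℤ.≤ b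
≤-by-difference {a} d 0≤d b≡a+d =
  ≡.subst (a ℤ.≤_) (≡.sym b≡a+d) (≡.subst (ℤ._≤ a + d) (ℤP.+-identityʳ a) (ℤP.+-monoʳ-≤ a 0≤d))

-- (2σ + 1)x − σ(σ + 1) is the chord of t ↦ t² through σ and σ + 1.
chord-≤-square : ∀ x σ → (+ 2 * + σ + + 1) * + x - + σ * (+ σ + + 1) ℤ.≤ + x * + x
chord-≤-square x σ with suc σ ≤? x
... | yes σ<x with ℕP.m≤n⇒∃[o]m+o≡n σ<x
...   | e , ≡.refl rewrite ℤP.pos-+ (suc σ) e | ℤP.pos-+ 1 σ =
  ≤-by-difference ((+ 1 + + e) * + e) (nonneg-* (nonneg-pos (suc e)) (nonneg-pos e)) (expand (+ σ) (+ e))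
  where
  expand : ∀ S E → (+ 1 + S + E) * (+ 1 + S + E)
                   ≡ (+ 2 * S + + 1) * (+ 1 + S + E) - S * (S + + 1) + (+ 1 + E) * E
  expand = solve-∀
chord-≤-square x σ | no σ≮x with ℕP.m≤n⇒∃[o]m+o≡n (ℕP.≤-pred (ℕP.≰⇒> σ≮x))
... | e , ≡.refl rewrite ℤP.pos-+ x e =
  ≤-by-difference (+ e * (+ e + + 1)) (nonneg-* (nonneg-pos e) (nonneg-pos (e ℕ.+ 1))) (expand (+ x) (+ e))
  where
  expand : ∀ X E → X * X ≡ (+ 2 * (X + E) + + 1) * X - (X + E) * ((X + E) + + 1) + E * (E + + 1)
  expand = solve-∀

-- p copies of the chord at σ, evaluated at a total m; a lower bound for the sum of squares
-- of p naturals with sum m (chordSum-≤-Σsquares), tight for the balanced choice σ = ⌊m/p⌋.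
chordSum : ℤ → ℤ → ℤ → ℤ
chordSum P S m = (+ 2 * S + + 1) * m - P * S * (S + + 1)

chordSum-≤-Σsquares : ∀ {p} (y : Fin p → ℕ) σ →
  chordSum (+ p) (+ σ) (+ sum (map y (allFin p))) ℤ.≤ + sum (map (λ c → y c ℕ.* y c) (allFin p))
chordSum-≤-Σsquares {p} y σ = begin
  chordSum (+ p) (+ σ) (+ sum (map y (allFin p)))
    ≡⟨ split (+ σ) (+ p) (+ sum (map y (allFin p))) ⟩
  slope * + sum (map y (allFin p)) + + p * (- offset)
    ≡⟨ ≡.cong₂ (λ s l → slope * s + + l * (- offset))
               (pos-sum y (allFin p)) (≡.sym (ListP.length-tabulate {n = p} (λ i → i))) ⟩
  slope * Σℤ (map (+_ ∘ y) (allFin p)) + + length (allFin p) * (- offset)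
    ≡⟨ ≡.cong₂ _+_ (ℤΣ.*-distribˡ-Σ slope (+_ ∘ y) (allFin p)) (Σℤ-const (- offset) (allFin p)) ⟨
  Σℤ (map (λ c → slope * + y c) (allFin p)) + Σℤ (map (λ _ → - offset) (allFin p))
    ≡⟨ ℤΣ.Σ-distrib-+ (λ c → slope * + y c) (λ _ → - offset) (allFin p) ⟨
  Σℤ (map (λ c → slope * + y c - offset) (allFin p))
    ≤⟨ Σℤ-mono-≤ (λ c → ℤP.≤-trans (chord-≤-square (y c) σ) (ℤP.≤-reflexive (≡.sym (ℤP.pos-* (y c) (y c)))))
                 (allFin p) ⟩
  Σℤ (map (λ c → + (y c ℕ.* y c)) (allFin p))
    ≡⟨ pos-sum (λ c → y c ℕ.* y c) (allFin p) ⟨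
  + sum (map (λ c → y c ℕ.* y c) (allFin p)) ∎
  where
  open ℤP.≤-Reasoning
  slope = + 2 * + σ + + 1
  offset = + σ * (+ σ + + 1)
  split : ∀ S P m → (+ 2 * S + + 1) * m - P * S * (S + + 1) ≡ (+ 2 * S + + 1) * m + P * (- (S * (S + + 1)))
  split = solve-∀

chordSum-≤-quotient : ∀ p t s σ → t < p →
  chordSum (+ p) (+ σ) (+ t + + s * + p) ℤ.≤ chordSum (+ p) (+ s) (+ t + + s * + p)
chordSum-≤-quotient p t s σ t<p with σ ≤? s
... | yes σ≤s with ℕP.m≤n⇒∃[o]m+o≡n σ≤s
...   | zero  , ≡.refl =
  ℤP.≤-reflexive (≡.cong (λ z → chordSum (+ p) (+ z) (+ t + + (σ ℕ.+ 0) * + p)) (≡.sym (ℕP.+-identityʳ σ)))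
...   | suc e , ≡.refl rewrite ℤP.pos-+ σ (suc e) | ℤP.pos-+ 1 e =
  ≤-by-difference (+ p * (+ 1 + + e) * + e + + 2 * + t * (+ 1 + + e))
    (nonneg-+ (nonneg-* (nonneg-* (nonneg-pos p) (nonneg-pos (suc e))) (nonneg-pos e))
              (nonneg-* (nonneg-* (nonneg-pos 2) (nonneg-pos t)) (nonneg-pos (suc e))))
    (expand (+ p) (+ t) (+ σ) (+ e))
  where
  expand : ∀ P T S E →
    (+ 2 * (S + (+ 1 + E)) + + 1) * (T + (S + (+ 1 + E)) * P) - P * (S + (+ 1 + E)) * ((S + (+ 1 + E)) + + 1)
      ≡ ((+ 2 * S + + 1) * (T + (S + (+ 1 + E)) * P) - P * S * (S + + 1))
        + (P * (+ 1 + E) * E + + 2 * T * (+ 1 + E))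
  expand = solve-∀
chordSum-≤-quotient p t s σ t<p | no σ≰s
  with ℕP.m≤n⇒∃[o]m+o≡n (ℕP.≰⇒> σ≰s) | ℕP.m≤n⇒∃[o]m+o≡n t<p
... | e , ≡.refl | u , ≡.refl rewrite ℤP.pos-+ (suc s) e | ℤP.pos-+ 1 s | ℤP.pos-+ (suc t) u | ℤP.pos-+ 1 t =
  ≤-by-difference ((+ 1 + + e) * (+ 2 * + u + + 2 + (+ t + + u + + 1) * + e))
    (nonneg-* (nonneg-pos (suc e))
              (nonneg-+ (nonneg-+ (nonneg-* (nonneg-pos 2) (nonneg-pos u)) (nonneg-pos 2))
                        (nonneg-* (nonneg-+ (nonneg-+ (nonneg-pos t) (nonneg-pos u)) (nonneg-pos 1)) (nonneg-pos e))))
    (expand (+ t) (+ u) (+ s) (+ e))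
  where
  expand : ∀ T U S E →
    (+ 2 * S + + 1) * (T + S * (+ 1 + T + U)) - (+ 1 + T + U) * S * (S + + 1)
      ≡ ((+ 2 * (+ 1 + S + E) + + 1) * (T + S * (+ 1 + T + U))
          - (+ 1 + T + U) * (+ 1 + S + E) * ((+ 1 + S + E) + + 1))
        + ((+ 1 + E) * (+ 2 * U + + 2 + (T + U + + 1) * E))
  expand = solve-∀

pos-2*[nC2] : ∀ n → + 2 * + (n C 2) ≡ + n * + n - + n
pos-2*[nC2] zero    = ≡.refl
pos-2*[nC2] (suc n) = begin
  + 2 * + (suc n C 2)               ≡⟨ ≡.cong (λ z → + 2 * + z) (≡.sym (nCk+nC[k+1]≡[n+1]C[k+1] n 1)) ⟩
  + 2 * + (n C 1 ℕ.+ n C 2)         ≡⟨ ≡.cong (λ z → + 2 * + (z ℕ.+ n C 2)) (nC1≡n n) ⟩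
  + 2 * (+ n + + (n C 2))           ≡⟨ ℤP.*-distribˡ-+ (+ 2) (+ n) (+ (n C 2)) ⟩
  + 2 * + n + + 2 * + (n C 2)       ≡⟨ ≡.cong (λ z → + 2 * + n + z) (pos-2*[nC2] n) ⟩
  + 2 * + n + (+ n * + n - + n)     ≡⟨ square-shift (+ n) ⟩
  + suc n * + suc n - + suc n       ∎
  where
  open ≡.≡-Reasoning
  square-shift : ∀ N → + 2 * N + (N * N - N) ≡ (+ 1 + N) * (+ 1 + N) - (+ 1 + N)
  square-shift = solve-∀

pos-bracket : ∀ p s t → + bracket (suc p) s t
  ≡ + ((p ∸ t) C 2) * (+ s * + s) + + (p ∸ t) * + t * + s * (+ s + + 1) + + (t C 2) * ((+ s + + 1) * (+ s + + 1))
pos-bracket p s t =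
  ≡.trans (ℤP.pos-+ (u₂ ℕ.* (s ℕ.* s) ℕ.+ u ℕ.* t ℕ.* s ℕ.* (s ℕ.+ 1)) (t₂ ℕ.* ((s ℕ.+ 1) ℕ.* (s ℕ.+ 1))))
          (≡.cong₂ _+_ (≡.trans (ℤP.pos-+ (u₂ ℕ.* (s ℕ.* s)) (u ℕ.* t ℕ.* s ℕ.* (s ℕ.+ 1)))
                                (≡.cong₂ _+_ first middle))
                       last)
  where
  u  = p ∸ t
  u₂ = u C 2
  t₂ = t C 2
  s+1 : + (s ℕ.+ 1) ≡ + s + + 1
  s+1 = ℤP.pos-+ s 1
  first : + (u₂ ℕ.* (s ℕ.* s)) ≡ + u₂ * (+ s * + s)
  first = ≡.trans (ℤP.pos-* u₂ (s ℕ.* s)) (≡.cong (+ u₂ *_) (ℤP.pos-* s s))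
  middle : + (u ℕ.* t ℕ.* s ℕ.* (s ℕ.+ 1)) ≡ + u * + t * + s * (+ s + + 1)
  middle = ≡.trans (ℤP.pos-* (u ℕ.* t ℕ.* s) (s ℕ.+ 1))
                   (≡.cong₂ _*_ (≡.trans (ℤP.pos-* (u ℕ.* t) s) (≡.cong (_* + s) (ℤP.pos-* u t))) s+1)
  last : + (t₂ ℕ.* ((s ℕ.+ 1) ℕ.* (s ℕ.+ 1))) ≡ + t₂ * ((+ s + + 1) * (+ s + + 1))
  last = ≡.trans (ℤP.pos-* t₂ ((s ℕ.+ 1) ℕ.* (s ℕ.+ 1)))
                 (≡.cong (+ t₂ *_) (≡.trans (ℤP.pos-* (s ℕ.+ 1) (s ℕ.+ 1)) (≡.cong₂ _*_ s+1 s+1)))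

module BalancedSquares (p : ℕ) .{{_ : ℕ.NonZero p}} where
  open import Data.Nat.DivMod using (_/_; _%_; m≡m%n+[m/n]*n; m%n<n; +-distrib-/-∣ʳ; m<n⇒m/n≡0; m*n/n≡m)
  open import Data.Nat.Divisibility using (divides-refl)

  quotient-unique : ∀ t s → t < p → (t ℕ.+ s ℕ.* p) / p ≡ s
  quotient-unique t s t<p =
    ≡.trans (+-distrib-/-∣ʳ t (divides-refl s)) (≡.cong₂ ℕ._+_ (m<n⇒m/n≡0 t<p) (m*n/n≡m s p))

  pos-divMod : ∀ m → + m ≡ + (m % p) + + (m / p) * + p
  pos-divMod m = ≡.trans (≡.cong +_ (m≡m%n+[m/n]*n m p))
                         (≡.trans (ℤP.pos-+ (m % p) _) (≡.cong (λ z → + (m % p) + z) (ℤP.pos-* (m / p) p)))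

  minSquares : ℕ → ℤ
  minSquares m = chordSum (+ p) (+ (m / p)) (+ m)

  chordSum-≤-minSquares : ∀ m σ → chordSum (+ p) (+ σ) (+ m) ℤ.≤ minSquares m
  chordSum-≤-minSquares m σ =
    ≡.subst (λ z → chordSum (+ p) (+ σ) z ℤ.≤ chordSum (+ p) (+ (m / p)) z) (≡.sym (pos-divMod m))
            (chordSum-≤-quotient p (m % p) (m / p) σ (m%n<n m p))

  minSquares-suc : ∀ a → minSquares (suc a) ≡ minSquares a + (+ 2 * + (a / p) + + 1)
  minSquares-suc a with suc (a % p) ℕ.≟ p
  ... | no a%p≢p-1 = begin
    minSquares (suc a)                      ≡⟨ ≡.cong (λ z → chordSum (+ p) (+ z) (+ suc a)) same-quotient ⟩
    chordSum (+ p) (+ (a / p)) (+ 1 + + a)  ≡⟨ step (+ p) (+ (a / p)) (+ a) ⟩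
    minSquares a + (+ 2 * + (a / p) + + 1)  ∎
    where
    open ≡.≡-Reasoning
    same-quotient : suc a / p ≡ a / p
    same-quotient = ≡.trans (≡.cong (λ z → suc z / p) (m≡m%n+[m/n]*n a p))
                            (quotient-unique (suc (a % p)) (a / p) (ℕP.≤∧≢⇒< (m%n<n a p) a%p≢p-1))
    step : ∀ P S A → (+ 2 * S + + 1) * (+ 1 + A) - P * S * (S + + 1)
                       ≡ (+ 2 * S + + 1) * A - P * S * (S + + 1) + (+ 2 * S + + 1)
    step = solve-∀
  ... | yes a%p≡p-1 = begin
    minSquares (suc a)
      ≡⟨ ≡.cong (λ z → chordSum (+ p) (+ z) (+ suc a)) next-quotient ⟩
    chordSum (+ p) (+ suc s) (+ suc a)
      ≡⟨ ≡.cong₂ (λ P A → chordSum P (+ 1 + + s) A) p≡1+t (≡.cong (λ z → + 1 + z) a≡t+s[1+t]) ⟩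
    chordSum (+ 1 + t) (+ 1 + + s) (+ 1 + (t + + s * (+ 1 + t)))
      ≡⟨ step t (+ s) ⟩
    chordSum (+ 1 + t) (+ s) (t + + s * (+ 1 + t)) + (+ 2 * + s + + 1)
      ≡⟨ ≡.cong₂ (λ P A → chordSum P (+ s) A + (+ 2 * + s + + 1)) p≡1+t a≡t+s[1+t] ⟨
    minSquares a + (+ 2 * + s + + 1) ∎
    where
    open ≡.≡-Reasoning
    s = a / p
    t = + (a % p)
    p≡1+t : + p ≡ + 1 + t
    p≡1+t = ≡.cong +_ (≡.sym a%p≡p-1)
    a≡t+s[1+t] : + a ≡ t + + s * (+ 1 + t)
    a≡t+s[1+t] = ≡.trans (pos-divMod a) (≡.cong (λ P → t + + s * P) p≡1+t)
    next-quotient : suc a / p ≡ suc s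
    next-quotient = ≡.trans (≡.cong (_/ p) (≡.trans (≡.cong suc (m≡m%n+[m/n]*n a p))
                                                    (≡.cong (ℕ._+ s ℕ.* p) a%p≡p-1)))
                            (quotient-unique 0 (suc s) (ℕ.>-nonZero⁻¹ p))
    step : ∀ t s → (+ 2 * (+ 1 + s) + + 1) * (+ 1 + (t + s * (+ 1 + t))) - (+ 1 + t) * (+ 1 + s) * ((+ 1 + s) + + 1)
                     ≡ (+ 2 * s + + 1) * (t + s * (+ 1 + t)) - (+ 1 + t) * s * (s + + 1) + (+ 2 * s + + 1)
    step = solve-∀

  bracket-minSquares : ∀ m → + 2 * + bracket (suc p) (m / p) (m % p) ≡ + m * + m - minSquares m
  bracket-minSquares m = begin
    + 2 * + bracket (suc p) s t
      ≡⟨ ≡.cong (+ 2 *_) (pos-bracket p s t) ⟩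
    + 2 * (+ ((p ∸ t) C 2) * s² + mixed + + (t C 2) * s₁²)
      ≡⟨ distribute (+ ((p ∸ t) C 2)) mixed (+ (t C 2)) s² s₁² ⟩
    (+ 2 * + ((p ∸ t) C 2)) * s² + + 2 * mixed + (+ 2 * + (t C 2)) * s₁²
      ≡⟨ ≡.cong₂ (λ x y → x * s² + + 2 * mixed + y * s₁²) (pos-2*[nC2] (p ∸ t)) (pos-2*[nC2] t) ⟩
    (uℤ * uℤ - uℤ) * s² + + 2 * mixed + (tℤ * tℤ - tℤ) * s₁²
      ≡⟨ complete-square uℤ tℤ sℤ ⟩
    (tℤ + sℤ * (uℤ + tℤ)) * (tℤ + sℤ * (uℤ + tℤ)) - chordSum (uℤ + tℤ) sℤ (tℤ + sℤ * (uℤ + tℤ))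
      ≡⟨ ≡.cong₂ (λ x P → x * x - chordSum P sℤ x) (≡.sym m≡t+s[u+t]) (≡.sym p≡u+t) ⟩
    + m * + m - minSquares m ∎
    where
    open ≡.≡-Reasoning
    s = m / p
    t = m % p
    sℤ = + s
    tℤ = + t
    uℤ = + (p ∸ t)
    s² = sℤ * sℤ
    s₁² = (sℤ + + 1) * (sℤ + + 1)
    mixed = uℤ * tℤ * sℤ * (sℤ + + 1)
    p≡u+t : + p ≡ uℤ + tℤ
    p≡u+t = ≡.trans (≡.cong +_ (≡.sym (ℕP.m∸n+n≡m (ℕP.<⇒≤ (m%n<n m p))))) (ℤP.pos-+ (p ∸ t) t)
    m≡t+s[u+t] : + m ≡ tℤ + sℤ * (uℤ + tℤ)
    m≡t+s[u+t] = ≡.trans (pos-divMod m) (≡.cong (λ P → tℤ + sℤ * P) p≡u+t)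
    distribute : ∀ a b c x y → + 2 * (a * x + b + c * y) ≡ (+ 2 * a) * x + + 2 * b + (+ 2 * c) * y
    distribute = solve-∀
    complete-square : ∀ U T S →
      (U * U - U) * (S * S) + + 2 * (U * T * S * (S + + 1)) + (T * T - T) * ((S + + 1) * (S + + 1))
        ≡ (T + S * (U + T)) * (T + S * (U + T))
          - ((+ 2 * S + + 1) * (T + S * (U + T)) - (U + T) * S * (S + + 1))
    complete-square = solve-∀

  -- An upper bound for 2·Σ_{c<d} x_c x_d over a column of length M with m nonzero entries.
  pairBound : ℕ → ℕ → ℤ
  pairBound M m = + M * + M - (+ M - + m) * (+ M - + m) - minSquares m

  pairBound-≤-secant : ∀ M m a →
    pairBound M m ℤ.≤ pairBound M a + (+ m - + a) * (pairBound M (suc a) - pairBound M a)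
  pairBound-≤-secant M m a = begin
    pairBound M m
      ≤⟨ ℤP.+-monoʳ-≤ (+ M * + M - (+ M - + m) * (+ M - + m)) (ℤP.neg-mono-≤ (chordSum-≤-minSquares m (a / p))) ⟩
    + M * + M - (+ M - + m) * (+ M - + m) - X
      ≡⟨ expand (+ M) (+ m) X ⟩
    (+ 2 * + M * + m - X) - + m * + m
      ≤⟨ ℤP.+-monoʳ-≤ (+ 2 * + M * + m - X) (ℤP.neg-mono-≤ (chord-≤-square m a)) ⟩
    (+ 2 * + M * + m - X) - ((+ 2 * + a + + 1) * + m - + a * (+ a + + 1))
      ≡⟨ linearise (+ M) (+ m) (+ a) (+ (a / p)) (+ p) ⟩
    pairBound M a + (+ m - + a) * ((+ M * + M - (+ M - (+ 1 + + a)) * (+ M - (+ 1 + + a))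
                                    - (minSquares a + (+ 2 * + (a / p) + + 1))) - pairBound M a)
      ≡⟨ ≡.cong (λ y → pairBound M a + (+ m - + a) * ((+ M * + M - (+ M - + suc a) * (+ M - + suc a) - y)
                                                         - pairBound M a))
                (minSquares-suc a) ⟨
    pairBound M a + (+ m - + a) * (pairBound M (suc a) - pairBound M a) ∎
    where
    open ℤP.≤-Reasoning
    X = chordSum (+ p) (+ (a / p)) (+ m)
    expand : ∀ M m X → M * M - (M - m) * (M - m) - X ≡ (+ 2 * M * m - X) - m * m
    expand = solve-∀
    linearise : ∀ M m A S P →
      (+ 2 * M * m - ((+ 2 * S + + 1) * m - P * S * (S + + 1))) - ((+ 2 * A + + 1) * m - A * (A + + 1))
        ≡ (M * M - (M - A) * (M - A) - ((+ 2 * S + + 1) * A - P * S * (S + + 1)))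
          + (m - A) * ((M * M - (M - (+ 1 + A)) * (M - (+ 1 + A))
                        - (((+ 2 * S + + 1) * A - P * S * (S + + 1)) + (+ 2 * S + + 1)))
                       - (M * M - (M - A) * (M - A) - ((+ 2 * S + + 1) * A - P * S * (S + + 1))))
    linearise = solve-∀

  pairBound-bracket : ∀ M a → pairBound M a ≡ + 2 * ((+ M - + a) * + a + + bracket (suc p) (a / p) (a % p))
  pairBound-bracket M a = begin
    + M * + M - (+ M - + a) * (+ M - + a) - minSquares a
      ≡⟨ ≡.cong (λ z → + M * + M - (+ M - + a) * (+ M - + a) - z) (swap-minus {y = + a * + a} (bracket-minSquares a)) ⟩
    + M * + M - (+ M - + a) * (+ M - + a) - (+ a * + a - + 2 * + bracket (suc p) (a / p) (a % p))
      ≡⟨ rearrange (+ M) (+ a) (+ bracket (suc p) (a / p) (a % p)) ⟩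
    + 2 * ((+ M - + a) * + a + + bracket (suc p) (a / p) (a % p)) ∎
    where
    open ≡.≡-Reasoning
    rearrange : ∀ M a b → M * M - (M - a) * (M - a) - (a * a - + 2 * b) ≡ + 2 * ((M - a) * a + b)
    rearrange = solve-∀
    swap-minus : ∀ {x y z} → x ≡ y - z → z ≡ y - x
    swap-minus {x} {y} {z} x≡y-z = ≡.trans (involution y z) (≡.cong (λ v → y - v) (≡.sym x≡y-z))
      where
      involution : ∀ y z → z ≡ y - (y - z)
      involution = solve-∀

  pairBound-slope : ℕ → ℕ → ℤ
  pairBound-slope M a = pairBound M (suc a) - pairBound M a

  -- Jensen's inequality for the concave sequence pairBound M, via its secant through a and a + 1.
  Σ²-pairBound-≤ : ∀ M a (f : A → B → ℕ) xs zs →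
    Σℤ (map (λ x → Σℤ (map (λ z → pairBound M (f x z)) zs)) xs)
      ℤ.≤ + (length xs ℕ.* length zs) * (pairBound M a - + a * pairBound-slope M a)
          + + sum (map (λ x → sum (map (f x) zs)) xs) * pairBound-slope M a
  Σ²-pairBound-≤ M a f xs zs = ℤP.≤-trans
    (Σℤ-mono-≤ (λ x → Σℤ-mono-≤ (λ z → ℤP.≤-trans (pairBound-≤-secant M (f x z) a)
                                                  (ℤP.≤-reflexive (regroup (pairBound M a) (+ f x z) (+ a) (pairBound-slope M a))))
                                zs) xs)
    (ℤP.≤-reflexive (Σℤ-affine² (pairBound M a - + a * pairBound-slope M a) f (pairBound-slope M a) xs zs))
    where
    regroup : ∀ h m a s → h + (m - a) * s ≡ h - a * s + m * s
    regroup = solve-∀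

module ColumnBound {c ℓ} (p : ℕ) .{{_ : ℕ.NonZero p}} (F : FiniteField c ℓ (suc p))
                   {M : ℕ} (a : Fin M → FiniteField.Carrier F) where
  private module F = FiniteField F
  open F using (0#; ω)
  open FieldFacts F
  open BalancedSquares p

  y : Fin (suc p) → ℕ
  y c = xcount F c a

  matches : Fin M → Fin (suc p) → ℕ
  matches r c = 𝟙 (does (a r F.≟ ω c))

  matches-once : ∀ r → sum (map (matches r) (allFin (suc p))) ≡ 1
  matches-once r = ℕΣ.Σ-unique (λ c → does (a r F.≟ ω c)) (λ _ → 1)
                     (dec-true (a r F.≟ ω c₀) (F.sym ωc₀≈ar))
                     (λ c ar≈ωc → F.ω-inj c c₀ (F.trans (F.sym (decided (a r F.≟ ω c) ar≈ωc)) (F.sym ωc₀≈ar)))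
    where
    c₀ = proj₁ (F.ω-surj (a r))
    ωc₀≈ar = proj₂ (F.ω-surj (a r))

  matches-zero : ∀ r → matches r fzero ≡ 𝟙 (isZero (a r))
  matches-zero r = ≡.cong 𝟙 (isZero-cong′ (a r))
    where
    ω₀≈0 = F.ω-first fzero ≡.refl
    isZero-cong′ : ∀ x → does (x F.≟ ω fzero) ≡ isZero x
    isZero-cong′ x with x F.≟ ω fzero | x F.≟ 0#
    ... | yes _    | yes _   = ≡.refl
    ... | no _     | no _    = ≡.refl
    ... | yes x≈ω₀ | no x≉0  = ⊥-elim (x≉0 (F.trans x≈ω₀ ω₀≈0))
    ... | no x≉ω₀  | yes x≈0 = ⊥-elim (x≉ω₀ (F.trans x≈0 (F.sym ω₀≈0)))

  xcount-by-rows : ∀ c → y c ≡ sum (map (λ r → matches r c) (allFin M))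
  xcount-by-rows c = length-filter-sum (λ r → a r F.≟ ω c) (allFin M)

  Σ-xcount : sum (map y (allFin (suc p))) ≡ M
  Σ-xcount = begin
    sum (map y (allFin (suc p)))
      ≡⟨ ℕΣ.Σ-cong xcount-by-rows (allFin (suc p)) ⟩
    sum (map (λ c → sum (map (λ r → matches r c) (allFin M))) (allFin (suc p)))
      ≡⟨ ℕΣ.Σ-swap (λ c r → matches r c) (allFin (suc p)) (allFin M) ⟩
    sum (map (λ r → sum (map (matches r) (allFin (suc p)))) (allFin M))
      ≡⟨ ℕΣ.Σ-cong matches-once (allFin M) ⟩
    sum (map (λ _ → 1) (allFin M))
      ≡⟨ ≡.trans (sum-const 1 (allFin M)) (ℕP.*-identityʳ _) ⟩
    length (allFin M)
      ≡⟨ ListP.length-tabulate (λ i → i) ⟩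
    M ∎
    where open ≡.≡-Reasoning

  Σ-xcount-nonzero : sum (map (y ∘ fsuc) (allFin p)) ≡ weight F a
  Σ-xcount-nonzero = begin
    sum (map (y ∘ fsuc) (allFin p))
      ≡⟨ ℕΣ.Σ-cong (xcount-by-rows ∘ fsuc) (allFin p) ⟩
    sum (map (λ c → sum (map (λ r → matches r (fsuc c)) (allFin M))) (allFin p))
      ≡⟨ ℕΣ.Σ-swap (λ c r → matches r (fsuc c)) (allFin p) (allFin M) ⟩
    sum (map (λ r → sum (map (matches r ∘ fsuc) (allFin p))) (allFin M))
      ≡⟨ ℕΣ.Σ-cong nonzero-match (allFin M) ⟩
    sum (map (λ r → 𝟙 (not (isZero (a r)))) (allFin M))
      ≡⟨ length-filter-sum (λ r → ¬? (a r F.≟ 0#)) (allFin M) ⟨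
    weight F a ∎
    where
    open ≡.≡-Reasoning
    nonzero-match : ∀ r → sum (map (matches r ∘ fsuc) (allFin p)) ≡ 𝟙 (not (isZero (a r)))
    nonzero-match r = ℕP.+-cancelˡ-≡ (𝟙 (isZero (a r))) _ _ (begin
      𝟙 (isZero (a r)) ℕ.+ sum (map (matches r ∘ fsuc) (allFin p))
        ≡⟨ ≡.trans (ℕΣ.Σ-allFin-suc (matches r))
                   (≡.cong (ℕ._+ sum (map (matches r ∘ fsuc) (allFin p))) (matches-zero r)) ⟨
      sum (map (matches r) (allFin (suc p)))
        ≡⟨ matches-once r ⟩
      1
        ≡⟨ 𝟙-split (isZero (a r)) ⟩
      𝟙 (isZero (a r)) ℕ.+ 𝟙 (not (isZero (a r))) ∎)
      where
      𝟙-split : ∀ b → 1 ≡ 𝟙 b ℕ.+ 𝟙 (not b)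
      𝟙-split true  = ≡.refl
      𝟙-split false = ≡.refl

  pairTerms-below : sum (map (pairTerm F a) (orderedPairs (suc p))) ≡ PairProducts.ΣΣ y (PairProducts.below y)
  pairTerms-below =
    ≡.trans (ℕΣ.Σ-concatMap (pairTerm F a) (λ c → map (pair c) (later c)) (allFin (suc p)))
            (ℕΣ.Σ-cong (λ c → ≡.trans (ℕΣ.Σ-map (pairTerm F a) (pair c) (later c))
                                      (ℕΣ.Σ-filter (λ d → T? (toℕ c ℕ.<ᵇ toℕ d)) (λ d → y c ℕ.* y d) (allFin (suc p))))
                       (allFin (suc p)))
    where
    later : Fin (suc p) → List (Fin (suc p))
    later c = filter (λ d → T? (toℕ c ℕ.<ᵇ toℕ d)) (allFin (suc p))


  belowSum : ℕ
  belowSum = PairProducts.ΣΣ y (PairProducts.below y)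

  Sq′ : ℕ
  Sq′ = sum (map (λ c → y (fsuc c) ℕ.* y (fsuc c)) (allFin p))

  zeros+weight : + y fzero + + weight F a ≡ + M
  zeros+weight = ≡.cong +_ (≡.trans (≡.cong (y fzero ℕ.+_) (≡.sym Σ-xcount-nonzero))
                                    (≡.trans (≡.sym (ℕΣ.Σ-allFin-suc y)) Σ-xcount))

  squares-split : + 2 * + belowSum + (+ y fzero * + y fzero + + Sq′) ≡ + M * + M
  squares-split = begin
    + 2 * + belowSum + (+ y fzero * + y fzero + + Sq′)
      ≡⟨ ≡.cong₂ _+_ (≡.sym (ℤP.pos-* 2 belowSum))
                     (≡.trans (≡.cong (_+ + Sq′) (≡.sym (ℤP.pos-* (y fzero) (y fzero))))
                              (≡.sym (ℤP.pos-+ (y fzero ℕ.* y fzero) Sq′))) ⟩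
    + (2 ℕ.* belowSum) + + (y fzero ℕ.* y fzero ℕ.+ Sq′)
      ≡⟨ ≡.sym (ℤP.pos-+ (2 ℕ.* belowSum) _) ⟩
    + (2 ℕ.* belowSum ℕ.+ (y fzero ℕ.* y fzero ℕ.+ Sq′))
      ≡⟨ ≡.cong (λ z → + (2 ℕ.* belowSum ℕ.+ z)) (≡.sym (ℕΣ.Σ-allFin-suc (λ c → y c ℕ.* y c))) ⟩
    + (2 ℕ.* belowSum ℕ.+ sum (map (λ c → y c ℕ.* y c) (allFin (suc p))))
      ≡⟨ ≡.cong +_ (PairProducts.pairs-identity y) ⟩
    + (sum (map y (allFin (suc p))) ℕ.* sum (map y (allFin (suc p))))
      ≡⟨ ≡.trans (≡.cong (λ z → + (z ℕ.* z)) Σ-xcount) (ℤP.pos-* M M) ⟩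
    + M * + M ∎
    where open ≡.≡-Reasoning

  twice-pairTerms-≤-pairBound :
    + 2 * + sum (map (pairTerm F a) (orderedPairs (suc p))) ℤ.≤ pairBound M (weight F a)
  twice-pairTerms-≤-pairBound = begin
    + 2 * + sum (map (pairTerm F a) (orderedPairs (suc p)))
      ≡⟨ ≡.cong (λ z → + 2 * + z) pairTerms-below ⟩
    + 2 * + belowSum
      ≡⟨ ≡-minus squares-split ⟩
    + M * + M - (+ y fzero * + y fzero + + Sq′)
      ≡⟨ ≡.cong (λ z → + M * + M - (z * z + + Sq′)) (≡-minus {+ y fzero} {+ m} zeros+weight) ⟩
    + M * + M - ((+ M - + m) * (+ M - + m) + + Sq′)
      ≡⟨ regroup (+ M * + M) ((+ M - + m) * (+ M - + m)) (+ Sq′) ⟩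
    + M * + M - (+ M - + m) * (+ M - + m) - + Sq′
      ≤⟨ ℤP.+-monoʳ-≤ (+ M * + M - (+ M - + m) * (+ M - + m))
                      (ℤP.neg-mono-≤ (≡.subst (λ z → chordSum (+ p) (+ (m / p)) (+ z) ℤ.≤ + Sq′)
                                              Σ-xcount-nonzero (chordSum-≤-Σsquares (y ∘ fsuc) (m / p)))) ⟩
    pairBound M m ∎
    where
    open ℤP.≤-Reasoning
    open import Data.Nat.DivMod using (_/_)
    m = weight F a
    regroup : ∀ a b c → a - (b + c) ≡ a - b - c
    regroup = solve-∀


module CodeBound {c ℓ} {d : ℕ} (F : FiniteField c ℓ (suc (suc d)))
                 {M′ n : ℕ} (code : Fin (suc M′) → Fin n → FiniteField.Carrier F)
                 (w k : ℕ) (weight≡w : ∀ r → weight F (code r) ≡ w) where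
  open import Data.Nat.DivMod using (_/_; _%_; m≡m%n+[m/n]*n; m*n/n≡m)
  open FieldCounting F
  open BalancedSquares (suc d)

  private
    p = suc d
    q = suc p
    M = suc M′
    As = allFuns k (nonzeros F)
    Is = increasingSeqs k n
    E = bigE q n k
    N = bigN q M n w k
    qₖ = quot N E
    rₖ = rem N E

  count-combinations : length As ℕ.* length Is ≡ E
  count-combinations = ≡.cong₂ ℕ._*_ (≡.trans (length-allFuns k (nonzeros F)) (≡.cong (ℕ._^ k) length-nonzeros))
                                     (length-increasingSeqs k n)

  q*totalWeight : + q * + totalWeight code k ≡ + (M ℕ.* p) * twoP q n w k
  q*totalWeight = ≡.trans (totalWeight-formula code k w weight≡w)
                          (≡.trans (≡.sym (ℤP.*-assoc (+ M) (+ p) _)) (≡.cong (_* twoP q n w k) (≡.sym (ℤP.pos-* M p))))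

  twoP-nonneg : NonNeg (twoP q n w k)
  twoP-nonneg = ℤP.*-cancelˡ-≤-pos (+ 0) (twoP q n w k) (+ (M ℕ.* p))
    (≡.subst₂ ℤ._≤_ (≡.sym (ℤP.*-zeroʳ (+ (M ℕ.* p)))) q*totalWeight
              (nonneg-* (nonneg-pos q) (nonneg-pos (totalWeight code k))))

  totalWeight≡N : totalWeight code k ≡ N
  totalWeight≡N = ≡.sym (≡.trans (≡.cong (_/ q) product) (m*n/n≡m (totalWeight code k) q))
    where
    product : p ℕ.* M ℕ.* ℤ.∣ twoP q n w k ∣ ≡ totalWeight code k ℕ.* q
    product = ℤP.+-injective (begin
      + (p ℕ.* M ℕ.* ℤ.∣ twoP q n w k ∣)   ≡⟨ ℤP.pos-* (p ℕ.* M) ℤ.∣ twoP q n w k ∣ ⟩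
      + (p ℕ.* M) * + ℤ.∣ twoP q n w k ∣   ≡⟨ ≡.cong₂ _*_ (≡.cong +_ (ℕP.*-comm p M)) (ℤP.0≤i⇒+∣i∣≡i twoP-nonneg) ⟩
      + (M ℕ.* p) * twoP q n w k           ≡⟨ q*totalWeight ⟨
      + q * + totalWeight code k           ≡⟨ ℤP.*-comm (+ q) (+ totalWeight code k) ⟩
      + totalWeight code k * + q           ≡⟨ ℤP.pos-* (totalWeight code k) q ⟨
      + (totalWeight code k ℕ.* q)         ∎)
      where open ≡.≡-Reasoning

  -- Also for E = 0, by the conventions quot N 0 = 0 and rem N 0 = N.
  N-divMod : N ≡ rₖ ℕ.+ qₖ ℕ.* E
  N-divMod with E
  ... | zero  = ≡.sym (ℕP.+-identityʳ N)
  ... | suc e = m≡m%n+[m/n]*n N (suc e)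

  pairTerms : (Fin k → FiniteField.Carrier F) → (Fin k → Fin n) → ℕ
  pairTerms α idx = sum (map (pairTerm F (combo F code α idx)) (orderedPairs q))

  twice-S : + 2 * + S F code k ≡ Σℤ (map (λ α → Σℤ (map (λ idx → + 2 * + pairTerms α idx) Is)) As)
  twice-S = begin
    + 2 * + S F code k
      ≡⟨ ≡.cong (+ 2 *_) (pos-sum (λ α → sum (map (pairTerms α) Is)) As) ⟩
    + 2 * Σℤ (map (λ α → + sum (map (pairTerms α) Is)) As)
      ≡⟨ ℤΣ.*-distribˡ-Σ (+ 2) (λ α → + sum (map (pairTerms α) Is)) As ⟨
    Σℤ (map (λ α → + 2 * + sum (map (pairTerms α) Is)) As)
      ≡⟨ ℤΣ.Σ-cong (λ α → ≡.trans (≡.cong (+ 2 *_) (pos-sum (pairTerms α) Is))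
                                  (≡.sym (ℤΣ.*-distribˡ-Σ (+ 2) (+_ ∘ pairTerms α) Is))) As ⟩
    Σℤ (map (λ α → Σℤ (map (λ idx → + 2 * + pairTerms α idx) Is)) As) ∎
    where open ≡.≡-Reasoning

  pairBounds-T : (+ E - + rₖ) * pairBound M qₖ + + rₖ * pairBound M (suc qₖ)
                   ≡ + 2 * (T₁ q M n w k + T₂ q M n w k + T₃ q M n w k)
  pairBounds-T = begin
    (+ E - + rₖ) * pairBound M qₖ + + rₖ * pairBound M (suc qₖ)
      ≡⟨ ≡.cong₂ (λ x y → (+ E - + rₖ) * x + + rₖ * y) (pairBound-bracket M qₖ)
                 (≡.trans (pairBound-bracket M (suc qₖ))
                          (≡.cong (λ a → + 2 * ((+ M - + suc qₖ) * + suc qₖ + + bracket q (a / p) (a % p)))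
                                  (ℕP.+-comm 1 qₖ))) ⟩
    (+ E - + rₖ) * (+ 2 * ((+ M - + qₖ) * + qₖ + b₀)) + + rₖ * (+ 2 * ((+ M - (+ 1 + + qₖ)) * (+ 1 + + qₖ) + b₁))
      ≡⟨ collect (+ E) (+ rₖ) (+ M) (+ qₖ) b₀ b₁ ⟩
    + 2 * (T₁ q M n w k + T₂ q M n w k + T₃ q M n w k) ∎
    where
    open ≡.≡-Reasoning
    b₀ = + bracket q (qₖ / p) (qₖ % p)
    b₁ = + bracket q ((qₖ ℕ.+ 1) / p) ((qₖ ℕ.+ 1) % p)
    collect : ∀ E r M a b₀ b₁ →
      (E - r) * (+ 2 * ((M - a) * a + b₀)) + r * (+ 2 * ((M - (+ 1 + a)) * (+ 1 + a) + b₁))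
        ≡ + 2 * ((E - r) * (M - a) * a + r * (M - a - + 1) * (a + + 1) + (E - r) * b₀ + r * b₁)
    collect = solve-∀

  twice-S-≤ : + 2 * + S F code k ℤ.≤ + 2 * (T₁ q M n w k + T₂ q M n w k + T₃ q M n w k)
  twice-S-≤ = begin
    + 2 * + S F code k
      ≡⟨ twice-S ⟩
    Σℤ (map (λ α → Σℤ (map (λ idx → + 2 * + pairTerms α idx) Is)) As)
      ≤⟨ Σℤ-mono-≤ (λ α → Σℤ-mono-≤ (λ idx → ColumnBound.twice-pairTerms-≤-pairBound p F (combo F code α idx)) Is) As ⟩
    Σℤ (map (λ α → Σℤ (map (λ idx → pairBound M (weight F (combo F code α idx))) Is)) As)
      ≤⟨ Σ²-pairBound-≤ M qₖ (λ α idx → weight F (combo F code α idx)) As Is ⟩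
    + (length As ℕ.* length Is) * (pairBound M qₖ - + qₖ * slope) + + totalWeight code k * slope
      ≡⟨ ≡.cong₂ (λ e t → + e * (pairBound M qₖ - + qₖ * slope) + + t * slope)
                 count-combinations (≡.trans totalWeight≡N N-divMod) ⟩
    + E * (pairBound M qₖ - + qₖ * slope) + + (rₖ ℕ.+ qₖ ℕ.* E) * slope
      ≡⟨ ≡.cong (λ t → + E * (pairBound M qₖ - + qₖ * slope) + t * slope)
                (≡.trans (ℤP.pos-+ rₖ (qₖ ℕ.* E)) (≡.cong (λ t → + rₖ + t) (ℤP.pos-* qₖ E))) ⟩
    + E * (pairBound M qₖ - + qₖ * slope) + (+ rₖ + + qₖ * + E) * slope
      ≡⟨ interpolate (+ E) (+ rₖ) (+ qₖ) (pairBound M qₖ) (pairBound M (suc qₖ)) ⟩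
    (+ E - + rₖ) * pairBound M qₖ + + rₖ * pairBound M (suc qₖ)
      ≡⟨ pairBounds-T ⟩
    + 2 * (T₁ q M n w k + T₂ q M n w k + T₃ q M n w k) ∎
    where
    open ℤP.≤-Reasoning
    slope = pairBound-slope M qₖ
    interpolate : ∀ E r a h₀ h₁ →
      E * (h₀ - a * (h₁ - h₀)) + (r + a * E) * (h₁ - h₀) ≡ (E - r) * h₀ + r * h₁
    interpolate = solve-∀

field-size-≥2 : ∀ {c ℓ q} → FiniteField c ℓ q → 2 ≤ q
field-size-≥2 {q = zero}        F with () ← proj₁ (FiniteField.ω-surj F (FiniteField.0# F))
field-size-≥2 {q = suc zero}    F = ⊥-elim (F.0≉1 (all-equal (F.ω-surj F.0#) (F.ω-surj F.1#)))
  where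
  module F = FiniteField F
  all-equal : ∀ {x y} → ∃ (λ i → F.ω i F.≈ x) → ∃ (λ i → F.ω i F.≈ y) → x F.≈ y
  all-equal (fzero , ω₀≈x) (fzero , ω₀≈y) = F.trans (F.sym ω₀≈x) ω₀≈y
field-size-≥2 {q = suc (suc _)} F = s≤s (s≤s z≤n)

lemma3p3 : ∀ {c ℓ : Level} {q : ℕ} (F : FiniteField c ℓ q)
             (M n w : ℕ) (code : Fin M → Fin n → FiniteField.Carrier F) →
             (∀ r r′ → (∀ i → FiniteField._≈_ F (code r i) (code r′ i)) → r ≡ r′) →
             (∀ r → weight F (code r) ≡ w) →
             1 ≤ M →
             ∀ k → 1 ≤ k → k ≤ n →
             (+ S F code k) ℤ.≤ (T₁ q M n w k ℤ.+ T₂ q M n w k ℤ.+ T₃ q M n w k)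
lemma3p3 F (suc M′) n w code _ weight≡w _ k _ _ with field-size-≥2 F
... | s≤s (s≤s _) = ℤP.*-cancelˡ-≤-pos _ _ (+ 2) (CodeBound.twice-S-≤ F code w k weight≡w)
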